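{- For all integers $n\ge 1$ and $k$, $$\mathfrak B_{2n}^{(k)}=\sum_{m=1}^n\sum_{l=1}^m(-1)^{n-m}4^{m-l}(2m)!\left\{ {n \atop m} \right\}_2\left\{ {m \atop l} \right\}_2\mathfrak C_{2l}^{(k)}.$$
   Context: The Stirling numbers of the second kind with level $2$, $\left\{ {n \atop k} \right\}_2$ ($n,k\ge0$), are defined by $\left\{ {n \atop k} \right\}_2=\left\{ {n-1 \atop k-1} \right\}_2+k^2\left\{ {n-1 \atop k} \right\}_2$ with $\left\{ {0 \atop 0} \right\}_2=1$ and $\left\{ {n \atop 0} \right\}_2=\left\{ {0 \atop n} \right\}_2=0$ for $n\ge1$. For an integer $k$, the poly-Bernoulli numbers with level $2$ are defined by $\sum_{n\ge0}\mathfrak B_n^{(k)}\frac{x^n}{n!}=\frac{{\rm Li}_{2,k}(2\sin(x/2))}{2\sin(x/2)}$ with ${\rm Li}_{2,k}(z)=\sum_{n\ge0}\frac{z^{2n+1}}{(2n+1)^k}$, and the poly-Cauchy numbers with level $2$ are defined by $\sum_{n\ge0}\mathfrak C_n^{(k)}\frac{x^n}{n!}={\rm Lif}_{2,k}({\rm arcsinh}\,x)$ with ${\rm Lif}_{2,k}(z)=\sum_{m\ge0}\frac{z^{2m}}{(2m)!(2m+1)^k}$ (as power series). -}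

module Defs where

open import Data.Nat as ℕ using (ℕ; zero; suc; _∸_)
open import Data.Nat.Base using (_!)
open import Data.Nat.Properties using (_!≢0)
import Data.Nat.Properties as ℕP
open import Data.Integer as ℤ using (ℤ; +_; -[1+_])
open import Data.Rational using (ℚ; 0ℚ; 1ℚ; _+_; _*_; -_; _/_)

⟦_⟧ : ℕ → ℚ
⟦ n ⟧ = + n / 1

_^Q_ : ℚ → ℕ → ℚ
p ^Q zero = 1ℚ
p ^Q suc n = p * (p ^Q n)

sgn : ℕ → ℚ
sgn zero = 1ℚ
sgn (suc n) = - sgn n

Σ< : ℕ → (ℕ → ℚ) → ℚ
Σ< zero f = 0ℚ
Σ< (suc n) f = Σ< n f + f n

-- Σ_{i=a}^{b} f i  (empty if b < a)
Σ[_⋯_] : ℕ → ℕ → (ℕ → ℚ) → ℚ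
Σ[ a ⋯ b ] f = Σ< (suc b ∸ a) (λ i → f (a ℕ.+ i))

Series : Set
Series = ℕ → ℚ

_⊛_ : Series → Series → Series
(f ⊛ g) n = Σ< (suc n) (λ i → f i * g (n ∸ i))

_^S_ : Series → ℕ → Series
f ^S zero = λ { zero → 1ℚ ; (suc _) → 0ℚ }
f ^S suc j = f ⊛ (f ^S j)

-- composition f(g(x)), meaningful when g has zero constant term
-- (then [x^n] g^j = 0 for j > n, so the sum is the full composition)
_∘S_ : Series → Series → Series
(f ∘S g) n = Σ< (suc n) (λ j → f j * (g ^S j) n)

egf : Series → ℕ → ℚ
egf f n = ⟦ n ! ⟧ * f n

-- 1 / m^k for an integer k and positive m = suc j  (i.e. (suc j)^(-k))

invPow : ℤ → ℕ → ℚ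
invPow (+ k) j = (+ 1 / suc j) ^Q k
invPow -[1+ k ] j = ⟦ suc j ⟧ ^Q suc k

oddInvPow : ℤ → ℕ → ℚ
oddInvPow k n = invPow k (2 ℕ.* n)

evenSeries : (ℕ → ℚ) → Series
evenSeries a n with n ℕ.% 2
... | zero = a (n ℕ./ 2)
... | suc _ = 0ℚ

oddSeries : (ℕ → ℚ) → Series
oddSeries a n with n ℕ.% 2
... | zero = 0ℚ
... | suc _ = a (n ℕ./ 2)

-- Li_{2,k}(z)/z = Σ_{n≥0} z^{2n}/(2n+1)^k
LiOverZ : ℤ → Series
LiOverZ k = evenSeries (λ n → oddInvPow k n)

inv : (n : ℕ) → .{{ℕ.NonZero n}} → ℚ
inv n = + 1 / n

twoSinHalf : Series
twoSinHalf = oddSeries (λ j → sgn j * (inv (4 ℕ.^ j) {{ℕP.m^n≢0 4 j}} * inv ((suc (2 ℕ.* j)) !) {{(suc (2 ℕ.* j)) !≢0}}))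

Lif : ℤ → Series
Lif k = evenSeries (λ m → inv ((2 ℕ.* m) !) {{(2 ℕ.* m) !≢0}} * oddInvPow k m)

arcsinh : Series
arcsinh = oddSeries (λ j → sgn j * ⟦ (2 ℕ.* j) ! ⟧ * inv (4 ℕ.^ j) {{ℕP.m^n≢0 4 j}}
                       * inv (j !) {{j !≢0}} * inv (j !) {{j !≢0}} * inv (suc (2 ℕ.* j)))

-- Poly-Bernoulli numbers with level 2:
--   Σ 𝔅_n^{(k)} x^n/n! = Li_{2,k}(2 sin(x/2)) / (2 sin(x/2))
polyBernoulli2 : ℤ → ℕ → ℚ
polyBernoulli2 k = egf (LiOverZ k ∘S twoSinHalf)

-- Poly-Cauchy numbers with level 2:
--   Σ 𝔠_n^{(k)} x^n/n! = Lif_{2,k}(arcsinh x)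
polyCauchy2 : ℤ → ℕ → ℚ
polyCauchy2 k = egf (Lif k ∘S arcsinh)

stirling2₂ : ℕ → ℕ → ℕ
stirling2₂ zero zero = 1
stirling2₂ zero (suc k) = 0
stirling2₂ (suc n) zero = 0
stirling2₂ (suc n) (suc k) = stirling2₂ n k ℕ.+ (suc k ℕ.* suc k) ℕ.* stirling2₂ n (suc k)

module Submission where

-- Write s = 2 sin(x/2) and a = arcsinh x. Both sides of the identity are sums over the even
-- powers s^(2i) and a^(2i), so everything reduces to their coefficients. From s″ = -s/4 and
-- (s′)² + s²/4 = 1 the powers satisfy (s^(j+2))″ = (j+2)(j+1) s^j - (j+2)² s^(j+2)/4, which is
-- the recurrence of the level-2 Stirling numbers: (2n)! [x^(2n)] s^(2i) = (2i)! (-1)^(n-i) {n,i}₂.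
-- From (1 + x²) a″ + x a′ = 0 and (1 + x²) a′² = 1 the powers satisfy
-- (1 + x²) (a^(j+2))″ + x (a^(j+2))′ = (j+2)(j+1) a^j, which gives
-- 4^i (2l)! [x^(2l)] a^(2i) = 4^l (2i)! t(l,i) for the signed level-2 Stirling numbers t of the
-- first kind. Hence 𝔅_(2n) = Σ_i (2i)! (-1)^(n-i) {n,i}₂ / (2i+1)^k and
-- 𝔠_(2l) = 4^l Σ_i t(l,i) 4^(-i) / (2i+1)^k, and the theorem is the inversion
-- Σ_l {m,l}₂ t(l,i) = δ_(m,i) applied inside the double sum.

open import Defs
open import Data.Nat as ℕ using (ℕ; zero; suc; _!)
open import Data.Nat.Properties using (_!≢0)
import Data.Nat.Properties as ℕP
import Data.Nat.DivMod as DM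
import Data.Nat.Coprimality as Cop
open import Data.Integer as ℤ using (ℤ)
open import Data.Rational using (ℚ; 0ℚ; 1ℚ; _+_; _*_; -_; mkℚ; 1/_; toℚᵘ)
import Data.Rational.Properties as QP
import Data.Integer.Properties as ZP
import Data.Rational.Unnormalised as QU
import Data.Rational.Unnormalised.Properties as QUP
open import Data.Rational.Solver
open +-*-Solver using (solve; _:=_; _:+_; _:*_; :-_; con)
open import Relation.Binary.PropositionalEquality
open import Relation.Nullary using (yes; no)
open import Data.Nat.Divisibility using (divides-refl)

open ≡-Reasoning

⟦⟧-mkℚ : ∀ n → ⟦ n ⟧ ≡ mkℚ (ℤ.+ n) 0 (Cop.sym (Cop.1-coprimeTo n))
⟦⟧-mkℚ n = QP.normalize-coprime (Cop.sym (Cop.1-coprimeTo n))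

⟦⟧-suc : ∀ n → ⟦ suc n ⟧ ≡ 1ℚ + ⟦ n ⟧
⟦⟧-suc n = QP.toℚᵘ-injective (subst₂ QU._≃_ (cong toℚᵘ (sym (⟦⟧-mkℚ (suc n))))
   (sym (cong (λ x → toℚᵘ (1ℚ + x)) (⟦⟧-mkℚ n)))
   (QUP.≃-trans (QU.*≡* numerators) (QUP.≃-sym (QP.toℚᵘ-homo-+ 1ℚ (mkℚ (ℤ.+ n) 0 (Cop.sym (Cop.1-coprimeTo n)))))))
  where
  numerators : (ℤ.+ suc n) ℤ.* (ℤ.+ 1) ≡ ((ℤ.+ 1) ℤ.* (ℤ.+ 1) ℤ.+ (ℤ.+ n) ℤ.* (ℤ.+ 1)) ℤ.* (ℤ.+ 1)
  numerators = trans (ZP.*-identityʳ (ℤ.+ suc n))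
    (sym (trans (ZP.*-identityʳ _) (cong (ℤ._+_ (ℤ.+ 1)) (ZP.*-identityʳ (ℤ.+ n)))))

⟦⟧-+ : ∀ m n → ⟦ m ℕ.+ n ⟧ ≡ ⟦ m ⟧ + ⟦ n ⟧
⟦⟧-+ zero n = sym (QP.+-identityˡ ⟦ n ⟧)
⟦⟧-+ (suc m) n = begin
  ⟦ suc (m ℕ.+ n) ⟧     ≡⟨ ⟦⟧-suc (m ℕ.+ n) ⟩
  1ℚ + ⟦ m ℕ.+ n ⟧      ≡⟨ cong (1ℚ +_) (⟦⟧-+ m n) ⟩
  1ℚ + (⟦ m ⟧ + ⟦ n ⟧)  ≡⟨ QP.+-assoc 1ℚ ⟦ m ⟧ ⟦ n ⟧ ⟨
  1ℚ + ⟦ m ⟧ + ⟦ n ⟧    ≡⟨ cong (_+ ⟦ n ⟧) (⟦⟧-suc m) ⟨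
  ⟦ suc m ⟧ + ⟦ n ⟧     ∎

⟦⟧-* : ∀ m n → ⟦ m ℕ.* n ⟧ ≡ ⟦ m ⟧ * ⟦ n ⟧
⟦⟧-* zero n = sym (QP.*-zeroˡ ⟦ n ⟧)
⟦⟧-* (suc m) n = begin
  ⟦ n ℕ.+ m ℕ.* n ⟧        ≡⟨ ⟦⟧-+ n (m ℕ.* n) ⟩
  ⟦ n ⟧ + ⟦ m ℕ.* n ⟧      ≡⟨ cong (⟦ n ⟧ +_) (⟦⟧-* m n) ⟩
  ⟦ n ⟧ + ⟦ m ⟧ * ⟦ n ⟧    ≡⟨ solve 2 (λ x y → x :+ y :* x := (con 1ℚ :+ y) :* x) refl ⟦ n ⟧ ⟦ m ⟧ ⟩
  (1ℚ + ⟦ m ⟧) * ⟦ n ⟧     ≡⟨ cong (_* ⟦ n ⟧) (⟦⟧-suc m) ⟨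
  ⟦ suc m ⟧ * ⟦ n ⟧        ∎

inv-inverseˡ : ∀ n .{{_ : ℕ.NonZero n}} → inv n * ⟦ n ⟧ ≡ 1ℚ
inv-inverseˡ (suc m) = trans (cong₂ _*_ inv≡1/ (⟦⟧-mkℚ (suc m))) (QP.*-inverseˡ q)
  where
  q = mkℚ (ℤ.+ suc m) 0 (Cop.sym (Cop.1-coprimeTo (suc m)))
  inv≡1/ : inv (suc m) ≡ 1/ q
  inv≡1/ = QP.normalize-coprime (Cop.1-coprimeTo (suc m))

inv-inverseʳ : ∀ n .{{_ : ℕ.NonZero n}} → ⟦ n ⟧ * inv n ≡ 1ℚ
inv-inverseʳ n = trans (QP.*-comm ⟦ n ⟧ (inv n)) (inv-inverseˡ n)

⟦⟧-cancelˡ : ∀ n x y .{{_ : ℕ.NonZero n}} → ⟦ n ⟧ * x ≡ ⟦ n ⟧ * y → x ≡ y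
⟦⟧-cancelˡ n x y eq = begin
  x                    ≡⟨ QP.*-identityˡ x ⟨
  1ℚ * x               ≡⟨ cong (_* x) (inv-inverseˡ n) ⟨
  inv n * ⟦ n ⟧ * x    ≡⟨ QP.*-assoc (inv n) _ _ ⟩
  inv n * (⟦ n ⟧ * x)  ≡⟨ cong (inv n *_) eq ⟩
  inv n * (⟦ n ⟧ * y)  ≡⟨ QP.*-assoc (inv n) _ _ ⟨
  inv n * ⟦ n ⟧ * y    ≡⟨ cong (_* y) (inv-inverseˡ n) ⟩
  1ℚ * y               ≡⟨ QP.*-identityˡ y ⟩
  y                    ∎

⟦⟧*x≡0⇒x≡0 : ∀ n x .{{_ : ℕ.NonZero n}} → ⟦ n ⟧ * x ≡ 0ℚ → x ≡ 0ℚ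
⟦⟧*x≡0⇒x≡0 n x eq = ⟦⟧-cancelˡ n x 0ℚ (trans eq (sym (QP.*-zeroʳ ⟦ n ⟧)))

inv-distrib-* : ∀ m n .{{_ : ℕ.NonZero m}} .{{_ : ℕ.NonZero n}} →
  inv (m ℕ.* n) {{ℕP.m*n≢0 m n}} ≡ inv m * inv n
inv-distrib-* m n = sym (⟦⟧-cancelˡ (m ℕ.* n) _ _ {{ℕP.m*n≢0 m n}} (begin
  ⟦ m ℕ.* n ⟧ * (inv m * inv n)      ≡⟨ cong (_* (inv m * inv n)) (⟦⟧-* m n) ⟩
  ⟦ m ⟧ * ⟦ n ⟧ * (inv m * inv n)    ≡⟨ solve 4 (λ a b c d → a :* b :* (c :* d) := (a :* c) :* (b :* d)) refl
                                          ⟦ m ⟧ ⟦ n ⟧ (inv m) (inv n) ⟩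
  (⟦ m ⟧ * inv m) * (⟦ n ⟧ * inv n)  ≡⟨ cong₂ _*_ (inv-inverseʳ m) (inv-inverseʳ n) ⟩
  1ℚ                                 ≡⟨ inv-inverseʳ (m ℕ.* n) {{ℕP.m*n≢0 m n}} ⟨
  ⟦ m ℕ.* n ⟧ * inv (m ℕ.* n) {{ℕP.m*n≢0 m n}} ∎))

Σ<-cong-< : ∀ n {f g : ℕ → ℚ} → (∀ i → i ℕ.< n → f i ≡ g i) → Σ< n f ≡ Σ< n g
Σ<-cong-< zero eq = refl
Σ<-cong-< (suc n) eq = cong₂ _+_ (Σ<-cong-< n (λ i i<n → eq i (ℕP.m<n⇒m<1+n i<n))) (eq n (ℕP.n<1+n n))

Σ<-cong : ∀ n {f g : ℕ → ℚ} → (∀ i → f i ≡ g i) → Σ< n f ≡ Σ< n g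
Σ<-cong n eq = Σ<-cong-< n (λ i _ → eq i)

Σ<-zero : ∀ n {f : ℕ → ℚ} → (∀ i → i ℕ.< n → f i ≡ 0ℚ) → Σ< n f ≡ 0ℚ
Σ<-zero n eq = trans (Σ<-cong-< n eq) (lemma n)
  where
  lemma : ∀ n → Σ< n (λ _ → 0ℚ) ≡ 0ℚ
  lemma zero = refl
  lemma (suc n) = cong (_+ 0ℚ) (lemma n)

Σ<-distrib-+ : ∀ n (f g : ℕ → ℚ) → Σ< n (λ i → f i + g i) ≡ Σ< n f + Σ< n g
Σ<-distrib-+ zero f g = refl
Σ<-distrib-+ (suc n) f g = trans (cong (_+ (f n + g n)) (Σ<-distrib-+ n f g))
  (solve 4 (λ a b c d → (a :+ b) :+ (c :+ d) := (a :+ c) :+ (b :+ d)) refl (Σ< n f) (Σ< n g) (f n) (g n))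

Σ<-*ˡ : ∀ n c (f : ℕ → ℚ) → Σ< n (λ i → c * f i) ≡ c * Σ< n f
Σ<-*ˡ zero c f = sym (QP.*-zeroʳ c)
Σ<-*ˡ (suc n) c f = trans (cong (_+ (c * f n)) (Σ<-*ˡ n c f)) (sym (QP.*-distribˡ-+ c _ _))

Σ<-*ʳ : ∀ n c (f : ℕ → ℚ) → Σ< n (λ i → f i * c) ≡ Σ< n f * c
Σ<-*ʳ n c f = trans (Σ<-cong n (λ i → QP.*-comm (f i) c)) (trans (Σ<-*ˡ n c f) (QP.*-comm c _))

Σ<-head : ∀ n (f : ℕ → ℚ) → Σ< (suc n) f ≡ f 0 + Σ< n (λ i → f (suc i))
Σ<-head zero f = trans (QP.+-identityˡ (f 0)) (sym (QP.+-identityʳ (f 0)))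
Σ<-head (suc n) f = trans (cong (_+ f (suc n)) (Σ<-head n f)) (QP.+-assoc (f 0) _ _)

Σ<-head-zero : ∀ n (f : ℕ → ℚ) → f 0 ≡ 0ℚ → Σ< (suc n) f ≡ Σ< n (λ i → f (suc i))
Σ<-head-zero n f f0≡0 = trans (Σ<-head n f) (trans (cong (_+ Σ< n (λ i → f (suc i))) f0≡0) (QP.+-identityˡ _))

Σ<-extend : ∀ n m {f : ℕ → ℚ} → n ℕ.≤ m → (∀ i → n ℕ.≤ i → f i ≡ 0ℚ) → Σ< m f ≡ Σ< n f
Σ<-extend n m {f} n≤m vanish = trans (cong (λ x → Σ< x f) (sym (ℕP.m+[n∸m]≡n n≤m))) (pad (m ℕ.∸ n))
  where
  pad : ∀ k → Σ< (n ℕ.+ k) f ≡ Σ< n f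
  pad zero = cong (λ x → Σ< x f) (ℕP.+-identityʳ n)
  pad (suc k) = begin
    Σ< (n ℕ.+ suc k) f            ≡⟨ cong (λ x → Σ< x f) (ℕP.+-suc n k) ⟩
    Σ< (n ℕ.+ k) f + f (n ℕ.+ k)  ≡⟨ cong₂ _+_ (pad k) (vanish _ (ℕP.m≤m+n n k)) ⟩
    Σ< n f + 0ℚ                   ≡⟨ QP.+-identityʳ _ ⟩
    Σ< n f                        ∎

Σ<-shift : ∀ n (f : ℕ → ℚ) → f 0 ≡ 0ℚ → f n ≡ 0ℚ → Σ< n (λ i → f (suc i)) ≡ Σ< n f
Σ<-shift n f f0≡0 fn≡0 = begin
  Σ< n (λ i → f (suc i))  ≡⟨ Σ<-head-zero n f f0≡0 ⟨
  Σ< n f + f n            ≡⟨ cong (Σ< n f +_) fn≡0 ⟩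
  Σ< n f + 0ℚ             ≡⟨ QP.+-identityʳ _ ⟩
  Σ< n f                  ∎

Σ<-swap : ∀ n m (F : ℕ → ℕ → ℚ) → Σ< n (λ i → Σ< m (F i)) ≡ Σ< m (λ j → Σ< n (λ i → F i j))
Σ<-swap zero m F = sym (Σ<-zero m (λ _ _ → refl))
Σ<-swap (suc n) m F = trans (cong (_+ Σ< m (F n)) (Σ<-swap n m F)) (sym (Σ<-distrib-+ m _ _))

Σ<-reverse : ∀ n (f : ℕ → ℚ) → Σ< n f ≡ Σ< n (λ i → f (n ℕ.∸ suc i))
Σ<-reverse zero f = refl
Σ<-reverse (suc n) f = begin
  Σ< n f + f n                        ≡⟨ QP.+-comm (Σ< n f) (f n) ⟩
  f n + Σ< n f                        ≡⟨ cong (f n +_) (Σ<-reverse n f) ⟩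
  f n + Σ< n (λ i → f (n ℕ.∸ suc i))  ≡⟨ Σ<-head n (λ i → f (n ℕ.∸ i)) ⟨
  Σ< (suc n) (λ i → f (n ℕ.∸ i))      ∎

2*suc : ∀ n → 2 ℕ.* suc n ≡ suc (suc (2 ℕ.* n))
2*suc n = ℕP.*-suc 2 n

Σ<-pairs : ∀ n (f : ℕ → ℚ) → Σ< (2 ℕ.* n) f ≡ Σ< n (λ i → f (2 ℕ.* i) + f (suc (2 ℕ.* i)))
Σ<-pairs zero f = refl
Σ<-pairs (suc n) f = begin
  Σ< (2 ℕ.* suc n) f                                  ≡⟨ cong (λ x → Σ< x f) (2*suc n) ⟩
  Σ< (2 ℕ.* n) f + f (2 ℕ.* n) + f (suc (2 ℕ.* n))    ≡⟨ QP.+-assoc (Σ< (2 ℕ.* n) f) _ _ ⟩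
  Σ< (2 ℕ.* n) f + (f (2 ℕ.* n) + f (suc (2 ℕ.* n)))  ≡⟨ cong (_+ (f (2 ℕ.* n) + f (suc (2 ℕ.* n)))) (Σ<-pairs n f) ⟩
  Σ< (suc n) (λ i → f (2 ℕ.* i) + f (suc (2 ℕ.* i)))  ∎

Σ<-triangle : ∀ n (F : ℕ → ℕ → ℚ) →
  Σ< n (λ i → Σ< (suc i) (λ a → F a i)) ≡ Σ< n (λ a → Σ< (n ℕ.∸ a) (λ b → F a (a ℕ.+ b)))
Σ<-triangle zero F = refl
Σ<-triangle (suc n) F = begin
  Σ< n (λ i → Σ< (suc i) (λ a → F a i)) + Σ< (suc n) (λ a → F a n)
    ≡⟨ cong (_+ Σ< (suc n) (λ a → F a n)) (Σ<-triangle n F) ⟩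
  Σ< n rows + Σ< (suc n) (λ a → F a n)
    ≡⟨ cong (_+ Σ< (suc n) (λ a → F a n)) (sym last-row-empty) ⟩
  Σ< (suc n) rows + Σ< (suc n) (λ a → F a n)
    ≡⟨ Σ<-distrib-+ (suc n) _ _ ⟨
  Σ< (suc n) (λ a → rows a + F a n)
    ≡⟨ Σ<-cong-< (suc n) extend-row ⟩
  Σ< (suc n) (λ a → Σ< (suc n ℕ.∸ a) (λ b → F a (a ℕ.+ b))) ∎
  where
  rows : ℕ → ℚ
  rows a = Σ< (n ℕ.∸ a) (λ b → F a (a ℕ.+ b))
  last-row-empty : Σ< (suc n) rows ≡ Σ< n rows
  last-row-empty = trans (cong (λ k → Σ< n rows + Σ< k (λ b → F n (n ℕ.+ b))) (ℕP.n∸n≡0 n)) (QP.+-identityʳ (Σ< n rows))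
  extend-row : ∀ a → a ℕ.< suc n → rows a + F a n ≡ Σ< (suc n ℕ.∸ a) (λ b → F a (a ℕ.+ b))
  extend-row a (ℕ.s≤s a≤n) = begin
    rows a + F a n                             ≡⟨ cong (λ x → rows a + F a x) (sym (ℕP.m+[n∸m]≡n a≤n)) ⟩
    Σ< (suc (n ℕ.∸ a)) (λ b → F a (a ℕ.+ b))   ≡⟨ cong (λ x → Σ< x (λ b → F a (a ℕ.+ b))) (sym (ℕP.+-∸-assoc 1 a≤n)) ⟩
    Σ< (suc n ℕ.∸ a) (λ b → F a (a ℕ.+ b))     ∎

δ : ℕ → ℕ → ℚ
δ zero zero = 1ℚ
δ zero (suc _) = 0ℚ
δ (suc _) zero = 0ℚ
δ (suc m) (suc i) = δ m i

Σ<-δ : ∀ n m (f : ℕ → ℚ) → m ℕ.< n → Σ< n (λ i → δ m i * f i) ≡ f m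
Σ<-δ (suc n) zero f _ = begin
  Σ< (suc n) (λ i → δ 0 i * f i)             ≡⟨ Σ<-head n _ ⟩
  1ℚ * f 0 + Σ< n (λ i → 0ℚ * f (suc i))     ≡⟨ cong₂ _+_ (QP.*-identityˡ (f 0)) (Σ<-zero n (λ i _ → QP.*-zeroˡ (f (suc i)))) ⟩
  f 0 + 0ℚ                                   ≡⟨ QP.+-identityʳ (f 0) ⟩
  f 0                                        ∎
Σ<-δ (suc n) (suc m) f (ℕ.s≤s m<n) = trans (Σ<-head-zero n _ (QP.*-zeroˡ (f 0))) (Σ<-δ n m (λ i → f (suc i)) m<n)

infix 4 _≈_
_≈_ : Series → Series → Set
f ≈ g = ∀ n → f n ≡ g n

≈-trans : ∀ {f g h} → f ≈ g → g ≈ h → f ≈ h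
≈-trans eq eq′ n = trans (eq n) (eq′ n)

infixl 6 _⊕_
_⊕_ : Series → Series → Series
(f ⊕ g) n = f n + g n

infixr 7 _·_
_·_ : ℚ → Series → Series
(c · f) n = c * f n

𝟙 : Series
𝟙 zero = 1ℚ
𝟙 (suc n) = 0ℚ

𝟘 : Series
𝟘 _ = 0ℚ

D : Series → Series
D f n = ⟦ suc n ⟧ * f (suc n)

X : Series → Series
X f zero = 0ℚ
X f (suc n) = f n

X² : Series → Series
X² f = X (X f)

^S-zero : ∀ f → f ^S 0 ≈ 𝟙
^S-zero f zero = refl
^S-zero f (suc n) = refl

⊛-cong : ∀ {f f′ g g′} → f ≈ f′ → g ≈ g′ → f ⊛ g ≈ f′ ⊛ g′
⊛-cong eq eq′ n = Σ<-cong (suc n) (λ i → cong₂ _*_ (eq i) (eq′ (n ℕ.∸ i)))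

⊛-congˡ : ∀ f {g g′} → g ≈ g′ → f ⊛ g ≈ f ⊛ g′
⊛-congˡ f = ⊛-cong {f} {f} (λ _ → refl)

⊛-congʳ : ∀ {f f′} g → f ≈ f′ → f ⊛ g ≈ f′ ⊛ g
⊛-congʳ g eq = ⊛-cong {g = g} {g} eq (λ _ → refl)

D-cong : ∀ {f g} → f ≈ g → D f ≈ D g
D-cong eq n = cong (⟦ suc n ⟧ *_) (eq (suc n))

X-cong : ∀ {f g} → f ≈ g → X f ≈ X g
X-cong eq zero = refl
X-cong eq (suc n) = eq n

⊛-comm : ∀ f g → f ⊛ g ≈ g ⊛ f
⊛-comm f g n = begin
  Σ< (suc n) (λ i → f i * g (n ℕ.∸ i))                  ≡⟨ Σ<-reverse (suc n) _ ⟩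
  Σ< (suc n) (λ i → f (n ℕ.∸ i) * g (n ℕ.∸ (n ℕ.∸ i)))  ≡⟨ Σ<-cong-< (suc n) flip ⟩
  Σ< (suc n) (λ i → g i * f (n ℕ.∸ i))                  ∎
  where
  flip : ∀ i → i ℕ.< suc n → f (n ℕ.∸ i) * g (n ℕ.∸ (n ℕ.∸ i)) ≡ g i * f (n ℕ.∸ i)
  flip i (ℕ.s≤s i≤n) = trans (cong (λ x → f (n ℕ.∸ i) * g x) (ℕP.m∸[m∸n]≡n i≤n)) (QP.*-comm (f (n ℕ.∸ i)) (g i))

⊛-assoc : ∀ f g h → (f ⊛ g) ⊛ h ≈ f ⊛ (g ⊛ h)
⊛-assoc f g h n = begin
  Σ< (suc n) (λ i → Σ< (suc i) (λ a → f a * g (i ℕ.∸ a)) * h (n ℕ.∸ i))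
    ≡⟨ Σ<-cong (suc n) (λ i → sym (Σ<-*ʳ (suc i) (h (n ℕ.∸ i)) _)) ⟩
  Σ< (suc n) (λ i → Σ< (suc i) (λ a → f a * g (i ℕ.∸ a) * h (n ℕ.∸ i)))
    ≡⟨ Σ<-triangle (suc n) (λ a i → f a * g (i ℕ.∸ a) * h (n ℕ.∸ i)) ⟩
  Σ< (suc n) (λ a → Σ< (suc n ℕ.∸ a) (λ b → f a * g ((a ℕ.+ b) ℕ.∸ a) * h (n ℕ.∸ (a ℕ.+ b))))
    ≡⟨ Σ<-cong-< (suc n) row ⟩
  Σ< (suc n) (λ a → f a * Σ< (suc (n ℕ.∸ a)) (λ b → g b * h ((n ℕ.∸ a) ℕ.∸ b))) ∎
  where
  row : ∀ a → a ℕ.< suc n →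
    Σ< (suc n ℕ.∸ a) (λ b → f a * g ((a ℕ.+ b) ℕ.∸ a) * h (n ℕ.∸ (a ℕ.+ b)))
    ≡ f a * Σ< (suc (n ℕ.∸ a)) (λ b → g b * h ((n ℕ.∸ a) ℕ.∸ b))
  row a (ℕ.s≤s a≤n) = begin
    Σ< (suc n ℕ.∸ a) (λ b → f a * g ((a ℕ.+ b) ℕ.∸ a) * h (n ℕ.∸ (a ℕ.+ b)))
      ≡⟨ cong (λ x → Σ< x (λ b → f a * g ((a ℕ.+ b) ℕ.∸ a) * h (n ℕ.∸ (a ℕ.+ b)))) (ℕP.+-∸-assoc 1 a≤n) ⟩
    Σ< (suc (n ℕ.∸ a)) (λ b → f a * g ((a ℕ.+ b) ℕ.∸ a) * h (n ℕ.∸ (a ℕ.+ b)))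
      ≡⟨ Σ<-cong (suc (n ℕ.∸ a)) (λ b → trans (cong₂ (λ x y → f a * g x * h y) (ℕP.m+n∸m≡n a b) (sym (ℕP.∸-+-assoc n a b)))
                                              (QP.*-assoc (f a) (g b) (h ((n ℕ.∸ a) ℕ.∸ b)))) ⟩
    Σ< (suc (n ℕ.∸ a)) (λ b → f a * (g b * h ((n ℕ.∸ a) ℕ.∸ b)))
      ≡⟨ Σ<-*ˡ (suc (n ℕ.∸ a)) (f a) _ ⟩
    f a * Σ< (suc (n ℕ.∸ a)) (λ b → g b * h ((n ℕ.∸ a) ℕ.∸ b)) ∎

⊛-identityˡ : ∀ f → 𝟙 ⊛ f ≈ f
⊛-identityˡ f n = begin
  Σ< (suc n) (λ i → 𝟙 i * f (n ℕ.∸ i))              ≡⟨ Σ<-head n _ ⟩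
  1ℚ * f n + Σ< n (λ i → 0ℚ * f (n ℕ.∸ suc i))      ≡⟨ cong₂ _+_ (QP.*-identityˡ (f n)) (Σ<-zero n (λ i _ → QP.*-zeroˡ (f (n ℕ.∸ suc i)))) ⟩
  f n + 0ℚ                                          ≡⟨ QP.+-identityʳ (f n) ⟩
  f n                                               ∎

⊛-identityʳ : ∀ f → f ⊛ 𝟙 ≈ f
⊛-identityʳ f = ≈-trans (⊛-comm f 𝟙) (⊛-identityˡ f)

⊛-zeroʳ : ∀ f {g} → g ≈ 𝟘 → f ⊛ g ≈ 𝟘
⊛-zeroʳ f g≈0 n = Σ<-zero (suc n) (λ i _ → trans (cong (f i *_) (g≈0 (n ℕ.∸ i))) (QP.*-zeroʳ (f i)))

⊛-distribˡ-⊕ : ∀ f g h → f ⊛ (g ⊕ h) ≈ f ⊛ g ⊕ f ⊛ h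
⊛-distribˡ-⊕ f g h n =
  trans (Σ<-cong (suc n) (λ i → QP.*-distribˡ-+ (f i) (g (n ℕ.∸ i)) (h (n ℕ.∸ i)))) (Σ<-distrib-+ (suc n) _ _)

*-lcomm : ∀ x y z → x * (y * z) ≡ y * (x * z)
*-lcomm = solve 3 (λ x y z → x :* (y :* z) := y :* (x :* z)) refl

⊛-·ʳ : ∀ c f g → f ⊛ (c · g) ≈ c · (f ⊛ g)
⊛-·ʳ c f g n = trans (Σ<-cong (suc n) (λ i → *-lcomm (f i) c (g (n ℕ.∸ i)))) (Σ<-*ˡ (suc n) c _)

⊛-·ˡ : ∀ c f g → (c · f) ⊛ g ≈ c · (f ⊛ g)
⊛-·ˡ c f g = ≈-trans (⊛-comm (c · f) g) (≈-trans (⊛-·ʳ c g f) (λ n → cong (c *_) (⊛-comm g f n)))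

D-⊕ : ∀ f g → D (f ⊕ g) ≈ D f ⊕ D g
D-⊕ f g n = QP.*-distribˡ-+ ⟦ suc n ⟧ (f (suc n)) (g (suc n))

D-· : ∀ c f → D (c · f) ≈ c · D f
D-· c f n = *-lcomm ⟦ suc n ⟧ c (f (suc n))

D-⊛ : ∀ f g → D (f ⊛ g) ≈ D f ⊛ g ⊕ f ⊛ D g
D-⊛ f g n = begin
  ⟦ suc n ⟧ * Σ< (suc (suc n)) (λ i → f i * g (suc n ℕ.∸ i))
    ≡⟨ Σ<-*ˡ (suc (suc n)) ⟦ suc n ⟧ _ ⟨
  Σ< (suc (suc n)) (λ i → ⟦ suc n ⟧ * (f i * g (suc n ℕ.∸ i)))
    ≡⟨ Σ<-cong-< (suc (suc n)) split ⟩
  Σ< (suc (suc n)) (λ i → ⟦ i ⟧ * (f i * g (suc n ℕ.∸ i)) + f i * (⟦ suc n ℕ.∸ i ⟧ * g (suc n ℕ.∸ i)))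
    ≡⟨ Σ<-distrib-+ (suc (suc n)) _ _ ⟩
  Σ< (suc (suc n)) (λ i → ⟦ i ⟧ * (f i * g (suc n ℕ.∸ i))) + Σ< (suc (suc n)) (λ i → f i * (⟦ suc n ℕ.∸ i ⟧ * g (suc n ℕ.∸ i)))
    ≡⟨ cong₂ _+_ left right ⟩
  (D f ⊛ g) n + (f ⊛ D g) n ∎
  where
  split : ∀ i → i ℕ.< suc (suc n) →
    ⟦ suc n ⟧ * (f i * g (suc n ℕ.∸ i)) ≡ ⟦ i ⟧ * (f i * g (suc n ℕ.∸ i)) + f i * (⟦ suc n ℕ.∸ i ⟧ * g (suc n ℕ.∸ i))
  split i (ℕ.s≤s i≤1+n) = trans
    (cong (_* (f i * g (suc n ℕ.∸ i))) (trans (cong ⟦_⟧ (sym (ℕP.m+[n∸m]≡n i≤1+n))) (⟦⟧-+ i (suc n ℕ.∸ i))))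
    (solve 4 (λ a b x y → (a :+ b) :* (x :* y) := a :* (x :* y) :+ x :* (b :* y)) refl
      ⟦ i ⟧ ⟦ suc n ℕ.∸ i ⟧ (f i) (g (suc n ℕ.∸ i)))
  left : Σ< (suc (suc n)) (λ i → ⟦ i ⟧ * (f i * g (suc n ℕ.∸ i))) ≡ (D f ⊛ g) n
  left = trans (Σ<-head-zero (suc n) _ (QP.*-zeroˡ (f 0 * g (suc n))))
               (Σ<-cong (suc n) (λ i → sym (QP.*-assoc ⟦ suc i ⟧ (f (suc i)) (g (n ℕ.∸ i)))))
  right : Σ< (suc (suc n)) (λ i → f i * (⟦ suc n ℕ.∸ i ⟧ * g (suc n ℕ.∸ i))) ≡ (f ⊛ D g) n
  right = begin
    Σ< (suc n) (λ i → f i * (⟦ suc n ℕ.∸ i ⟧ * g (suc n ℕ.∸ i))) + f (suc n) * (⟦ n ℕ.∸ n ⟧ * g (n ℕ.∸ n))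
      ≡⟨ cong₂ _+_ (Σ<-cong-< (suc n) (λ i i<1+n → cong (λ x → f i * (⟦ x ⟧ * g x)) (ℕP.+-∸-assoc 1 (ℕP.≤-pred i<1+n))))
                   (cong (λ x → f (suc n) * (⟦ x ⟧ * g x)) (ℕP.n∸n≡0 n)) ⟩
    (f ⊛ D g) n + f (suc n) * (0ℚ * g 0)
      ≡⟨ cong ((f ⊛ D g) n +_) (trans (cong (f (suc n) *_) (QP.*-zeroˡ (g 0))) (QP.*-zeroʳ (f (suc n)))) ⟩
    (f ⊛ D g) n + 0ℚ ≡⟨ QP.+-identityʳ _ ⟩
    (f ⊛ D g) n ∎

D-^S : ∀ f j → D (f ^S suc j) ≈ ⟦ suc j ⟧ · ((f ^S j) ⊛ D f)
D-^S f zero n = begin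
  D (f ⊛ (f ^S 0)) n      ≡⟨ D-cong (≈-trans (⊛-congˡ f (^S-zero f)) (⊛-identityʳ f)) n ⟩
  D f n                   ≡⟨ ⊛-identityˡ (D f) n ⟨
  (𝟙 ⊛ D f) n             ≡⟨ ⊛-congʳ (D f) (^S-zero f) n ⟨
  ((f ^S 0) ⊛ D f) n      ≡⟨ QP.*-identityˡ _ ⟨
  ⟦ 1 ⟧ * ((f ^S 0) ⊛ D f) n ∎
D-^S f (suc j) n = begin
  D (f ⊛ (f ^S suc j)) n                              ≡⟨ D-⊛ f (f ^S suc j) n ⟩
  (D f ⊛ (f ^S suc j)) n + (f ⊛ D (f ^S suc j)) n     ≡⟨ cong₂ _+_ (⊛-comm (D f) (f ^S suc j) n) (⊛-congˡ f (D-^S f j) n) ⟩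
  u n + (f ⊛ (⟦ suc j ⟧ · ((f ^S j) ⊛ D f))) n        ≡⟨ cong (u n +_) (⊛-·ʳ ⟦ suc j ⟧ f ((f ^S j) ⊛ D f) n) ⟩
  u n + ⟦ suc j ⟧ * (f ⊛ ((f ^S j) ⊛ D f)) n          ≡⟨ cong (λ x → u n + ⟦ suc j ⟧ * x) (⊛-assoc f (f ^S j) (D f) n) ⟨
  u n + ⟦ suc j ⟧ * u n                               ≡⟨ solve 2 (λ x y → x :+ y :* x := (con 1ℚ :+ y) :* x) refl (u n) ⟦ suc j ⟧ ⟩
  (1ℚ + ⟦ suc j ⟧) * u n                              ≡⟨ cong (_* u n) (⟦⟧-suc (suc j)) ⟨
  ⟦ suc (suc j) ⟧ * u n                               ∎
  where
  u = (f ^S suc j) ⊛ D f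

D≈𝟘⇒≈𝟙 : ∀ f → D f ≈ 𝟘 → f 0 ≡ 1ℚ → f ≈ 𝟙
D≈𝟘⇒≈𝟙 f Df≈0 f0≡1 zero = f0≡1
D≈𝟘⇒≈𝟙 f Df≈0 f0≡1 (suc n) = ⟦⟧*x≡0⇒x≡0 (suc n) (f (suc n)) (Df≈0 n)

X-⊕ : ∀ f g → X (f ⊕ g) ≈ X f ⊕ X g
X-⊕ f g zero = refl
X-⊕ f g (suc n) = refl

X-· : ∀ c f → X (c · f) ≈ c · X f
X-· c f zero = sym (QP.*-zeroʳ c)
X-· c f (suc n) = refl

X-⊛ : ∀ f g → X f ⊛ g ≈ X (f ⊛ g)
X-⊛ f g zero = trans (QP.+-identityˡ (0ℚ * g 0)) (QP.*-zeroˡ (g 0))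
X-⊛ f g (suc n) = Σ<-head-zero (suc n) _ (QP.*-zeroˡ (g (suc n)))

⊛-X : ∀ f g → f ⊛ X g ≈ X (f ⊛ g)
⊛-X f g = ≈-trans (⊛-comm f (X g)) (≈-trans (X-⊛ g f) (X-cong (⊛-comm g f)))

D-X : ∀ f → D (X f) ≈ f ⊕ X (D f)
D-X f zero = trans (QP.*-identityˡ (f 0)) (sym (QP.+-identityʳ (f 0)))
D-X f (suc n) = trans (cong (_* f (suc n)) (⟦⟧-suc (suc n)))
  (trans (QP.*-distribʳ-+ (f (suc n)) 1ℚ ⟦ suc n ⟧) (cong (_+ (⟦ suc n ⟧ * f (suc n))) (QP.*-identityˡ (f (suc n)))))

X²-⊕ : ∀ f g → X² (f ⊕ g) ≈ X² f ⊕ X² g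
X²-⊕ f g = ≈-trans (X-cong (X-⊕ f g)) (X-⊕ (X f) (X g))

X²-· : ∀ c f → X² (c · f) ≈ c · X² f
X²-· c f = ≈-trans (X-cong (X-· c f)) (X-· c (X f))

⊛-X² : ∀ f g → f ⊛ X² g ≈ X² (f ⊛ g)
⊛-X² f g = ≈-trans (⊛-X f (X g)) (X-cong (⊛-X f g))

2*n%2≡0 : ∀ n → (2 ℕ.* n) ℕ.% 2 ≡ 0
2*n%2≡0 n = trans (cong (ℕ._% 2) (ℕP.*-comm 2 n)) (DM.m*n%n≡0 n 2)

1+2*n%2≡1 : ∀ n → suc (2 ℕ.* n) ℕ.% 2 ≡ 1
1+2*n%2≡1 n = trans (cong (λ x → suc x ℕ.% 2) (ℕP.*-comm 2 n)) (DM.[m+kn]%n≡m%n 1 n 2)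

2*n/2≡n : ∀ n → (2 ℕ.* n) ℕ./ 2 ≡ n
2*n/2≡n n = trans (cong (ℕ._/ 2) (ℕP.*-comm 2 n)) (DM.m*n/n≡m n 2)

1+2*n/2≡n : ∀ n → suc (2 ℕ.* n) ℕ./ 2 ≡ n
1+2*n/2≡n n = trans (cong (λ x → suc x ℕ./ 2) (ℕP.*-comm 2 n))
                    (trans (DM.+-distrib-/-∣ʳ 1 {d = 2} (divides-refl n)) (DM.m*n/n≡m n 2))

evenSeries-even : ∀ a n → evenSeries a (2 ℕ.* n) ≡ a n
evenSeries-even a n rewrite 2*n%2≡0 n = cong a (2*n/2≡n n)

evenSeries-odd : ∀ a n → evenSeries a (suc (2 ℕ.* n)) ≡ 0ℚ
evenSeries-odd a n rewrite 1+2*n%2≡1 n = refl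

oddSeries-even : ∀ a n → oddSeries a (2 ℕ.* n) ≡ 0ℚ
oddSeries-even a n rewrite 2*n%2≡0 n = refl

oddSeries-odd : ∀ a n → oddSeries a (suc (2 ℕ.* n)) ≡ a n
oddSeries-odd a n rewrite 1+2*n%2≡1 n = cong a (1+2*n/2≡n n)

∘S-evenSeries : ∀ c f n → (evenSeries c ∘S f) (2 ℕ.* n) ≡ Σ< (suc n) (λ i → c i * (f ^S (2 ℕ.* i)) (2 ℕ.* n))
∘S-evenSeries c f n = begin
  Σ< (2 ℕ.* n) g + g (2 ℕ.* n)  ≡⟨ cong (_+ g (2 ℕ.* n)) (trans (Σ<-pairs n g) (Σ<-cong n pair-term)) ⟩
  Σ< n h + g (2 ℕ.* n)          ≡⟨ cong (Σ< n h +_) (even-term n) ⟩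
  Σ< (suc n) h                  ∎
  where
  g : ℕ → ℚ
  g j = evenSeries c j * (f ^S j) (2 ℕ.* n)
  h : ℕ → ℚ
  h i = c i * (f ^S (2 ℕ.* i)) (2 ℕ.* n)
  even-term : ∀ i → g (2 ℕ.* i) ≡ h i
  even-term i = cong (_* (f ^S (2 ℕ.* i)) (2 ℕ.* n)) (evenSeries-even c i)
  pair-term : ∀ i → g (2 ℕ.* i) + g (suc (2 ℕ.* i)) ≡ h i
  pair-term i = trans (cong₂ _+_ (even-term i)
                                (trans (cong (_* (f ^S suc (2 ℕ.* i)) (2 ℕ.* n)) (evenSeries-odd c i)) (QP.*-zeroˡ ((f ^S suc (2 ℕ.* i)) (2 ℕ.* n)))))
                              (QP.+-identityʳ (h i))

data Parity : ℕ → Set where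
  even : ∀ n → Parity (2 ℕ.* n)
  odd  : ∀ n → Parity (suc (2 ℕ.* n))

parity : ∀ n → Parity n
parity zero = even 0
parity (suc n) with parity n
... | even k = odd k
... | odd k = subst Parity (2*suc k) (even (suc k))

¼ : ℚ
¼ = inv 4

inv4^ : ℕ → ℚ
inv4^ j = inv (4 ℕ.^ j) {{ℕP.m^n≢0 4 j}}

inv! : ℕ → ℚ
inv! m = inv (m !) {{m !≢0}}

inv4^-suc : ∀ j → inv4^ (suc j) ≡ ¼ * inv4^ j
inv4^-suc j = inv-distrib-* 4 (4 ℕ.^ j) {{_}} {{ℕP.m^n≢0 4 j}}

inv!-suc : ∀ m → inv! (suc m) ≡ inv (suc m) * inv! m
inv!-suc m = inv-distrib-* (suc m) (m !) {{_}} {{m !≢0}}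

⟦⟧-!-suc² : ∀ m → ⟦ suc (suc m) ! ⟧ ≡ ⟦ suc (suc m) ⟧ * (⟦ suc m ⟧ * ⟦ m ! ⟧)
⟦⟧-!-suc² m = trans (⟦⟧-* (suc (suc m)) (suc m !)) (cong (⟦ suc (suc m) ⟧ *_) (⟦⟧-* (suc m) (m !)))

⟦⟧-4^-suc : ∀ m → ⟦ 4 ℕ.^ suc m ⟧ ≡ (⟦ 2 ⟧ * ⟦ 2 ⟧) * ⟦ 4 ℕ.^ m ⟧
⟦⟧-4^-suc m = trans (⟦⟧-* 4 (4 ℕ.^ m)) (cong (_* ⟦ 4 ℕ.^ m ⟧) (⟦⟧-* 2 2))

⟦⟧-2*suc : ∀ m → ⟦ suc (suc (2 ℕ.* m)) ⟧ ≡ ⟦ 2 ⟧ * ⟦ suc m ⟧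
⟦⟧-2*suc m = trans (cong ⟦_⟧ (sym (2*suc m))) (⟦⟧-* 2 (suc m))

¼*⟦2+2m⟧²≡⟦1+m⟧² : ∀ m → ¼ * (⟦ suc (suc (2 ℕ.* m)) ⟧ * ⟦ suc (suc (2 ℕ.* m)) ⟧) ≡ ⟦ suc m ℕ.* suc m ⟧
¼*⟦2+2m⟧²≡⟦1+m⟧² m = begin
  ¼ * (⟦ suc (suc (2 ℕ.* m)) ⟧ * ⟦ suc (suc (2 ℕ.* m)) ⟧)
    ≡⟨ cong (λ x → ¼ * (x * x)) (⟦⟧-2*suc m) ⟩
  ¼ * ((⟦ 2 ⟧ * ⟦ suc m ⟧) * (⟦ 2 ⟧ * ⟦ suc m ⟧))
    ≡⟨ solve 3 (λ q t k → q :* ((t :* k) :* (t :* k)) := (t :* t :* q) :* (k :* k)) refl ¼ ⟦ 2 ⟧ ⟦ suc m ⟧ ⟩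
  (⟦ 2 ⟧ * ⟦ 2 ⟧ * ¼) * (⟦ suc m ⟧ * ⟦ suc m ⟧)
    ≡⟨ QP.*-identityˡ _ ⟩
  ⟦ suc m ⟧ * ⟦ suc m ⟧
    ≡⟨ ⟦⟧-* (suc m) (suc m) ⟨
  ⟦ suc m ℕ.* suc m ⟧ ∎

^S-suc-at-0 : ∀ f → f 0 ≡ 0ℚ → ∀ m → (f ^S suc m) 0 ≡ 0ℚ
^S-suc-at-0 f f0≡0 m = trans (QP.+-identityˡ (f 0 * (f ^S m) 0))
  (trans (cong (_* (f ^S m) 0) f0≡0) (QP.*-zeroˡ ((f ^S m) 0)))

^S-2+-at-1 : ∀ f → f 0 ≡ 0ℚ → ∀ m → (f ^S suc (suc m)) 1 ≡ 0ℚ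
^S-2+-at-1 f f0≡0 m = begin
  (0ℚ + f 0 * g 1) + f 1 * g 0  ≡⟨ cong₂ (λ x y → (0ℚ + x * g 1) + f 1 * y) f0≡0 (^S-suc-at-0 f f0≡0 m) ⟩
  (0ℚ + 0ℚ * g 1) + f 1 * 0ℚ    ≡⟨ cong₂ (λ x y → (0ℚ + x) + y) (QP.*-zeroˡ (g 1)) (QP.*-zeroʳ (f 1)) ⟩
  0ℚ                            ∎
  where
  g = f ^S suc m

sinCoeff : ℕ → ℚ
sinCoeff j = sgn j * (inv4^ j * inv! (suc (2 ℕ.* j)))

twoSinHalf-even : ∀ j → twoSinHalf (2 ℕ.* j) ≡ 0ℚ
twoSinHalf-even = oddSeries-even _

twoSinHalf-odd : ∀ j → twoSinHalf (suc (2 ℕ.* j)) ≡ sinCoeff j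
twoSinHalf-odd = oddSeries-odd _

sinCoeff-suc : ∀ j → ⟦ suc (suc (2 ℕ.* j)) ⟧ * (⟦ suc (suc (suc (2 ℕ.* j))) ⟧ * sinCoeff (suc j)) ≡ (- ¼) * sinCoeff j
sinCoeff-suc j = begin
  ⟦ a ⟧ * (⟦ b ⟧ * (- sgn j * (inv4^ (suc j) * inv! (suc (2 ℕ.* suc j)))))
    ≡⟨ cong (λ x → ⟦ a ⟧ * (⟦ b ⟧ * (- sgn j * (inv4^ (suc j) * inv! (suc x))))) (2*suc j) ⟩
  ⟦ a ⟧ * (⟦ b ⟧ * (- sgn j * (inv4^ (suc j) * inv! b)))
    ≡⟨ cong₂ (λ x y → ⟦ a ⟧ * (⟦ b ⟧ * (- sgn j * (x * y)))) (inv4^-suc j)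
             (trans (inv!-suc a) (cong (inv b *_) (inv!-suc (suc (2 ℕ.* j))))) ⟩
  ⟦ a ⟧ * (⟦ b ⟧ * (- sgn j * ((¼ * inv4^ j) * (inv b * (inv a * inv! (suc (2 ℕ.* j)))))))
    ≡⟨ solve 8 (λ A ia B ib g q P F → A :* (B :* (:- g :* ((q :* P) :* (ib :* (ia :* F)))))
                  := (A :* ia) :* (B :* ib) :* ((:- q) :* (g :* (P :* F)))) refl
         ⟦ a ⟧ (inv a) ⟦ b ⟧ (inv b) (sgn j) ¼ (inv4^ j) (inv! (suc (2 ℕ.* j))) ⟩
  (⟦ a ⟧ * inv a) * (⟦ b ⟧ * inv b) * ((- ¼) * sinCoeff j)
    ≡⟨ cong₂ (λ x y → x * y * ((- ¼) * sinCoeff j)) (inv-inverseʳ a) (inv-inverseʳ b) ⟩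
  1ℚ * 1ℚ * ((- ¼) * sinCoeff j)
    ≡⟨ QP.*-identityˡ _ ⟩
  (- ¼) * sinCoeff j ∎
  where
  a = suc (suc (2 ℕ.* j))
  b = suc a

cosHalf : Series
cosHalf = D twoSinHalf

D-cosHalf : D cosHalf ≈ (- ¼) · twoSinHalf
D-cosHalf n with parity n
... | even j = begin
  ⟦ suc (2 ℕ.* j) ⟧ * (⟦ suc (suc (2 ℕ.* j)) ⟧ * twoSinHalf (suc (suc (2 ℕ.* j))))
    ≡⟨ cong (λ x → ⟦ suc (2 ℕ.* j) ⟧ * (⟦ suc (suc (2 ℕ.* j)) ⟧ * x))
            (trans (cong twoSinHalf (sym (2*suc j))) (twoSinHalf-even (suc j))) ⟩
  ⟦ suc (2 ℕ.* j) ⟧ * (⟦ suc (suc (2 ℕ.* j)) ⟧ * 0ℚ)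
    ≡⟨ solve 2 (λ a b → a :* (b :* con 0ℚ) := con 0ℚ) refl ⟦ suc (2 ℕ.* j) ⟧ ⟦ suc (suc (2 ℕ.* j)) ⟧ ⟩
  0ℚ
    ≡⟨ QP.*-zeroʳ (- ¼) ⟨
  (- ¼) * 0ℚ
    ≡⟨ cong ((- ¼) *_) (twoSinHalf-even j) ⟨
  (- ¼) * twoSinHalf (2 ℕ.* j) ∎
... | odd j = begin
  ⟦ suc (suc (2 ℕ.* j)) ⟧ * (⟦ suc (suc (suc (2 ℕ.* j))) ⟧ * twoSinHalf (suc (suc (suc (2 ℕ.* j)))))
    ≡⟨ cong (λ x → ⟦ suc (suc (2 ℕ.* j)) ⟧ * (⟦ suc (suc (suc (2 ℕ.* j))) ⟧ * x))
            (trans (cong (λ x → twoSinHalf (suc x)) (sym (2*suc j))) (twoSinHalf-odd (suc j))) ⟩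
  ⟦ suc (suc (2 ℕ.* j)) ⟧ * (⟦ suc (suc (suc (2 ℕ.* j))) ⟧ * sinCoeff (suc j))
    ≡⟨ sinCoeff-suc j ⟩
  (- ¼) * sinCoeff j
    ≡⟨ cong ((- ¼) *_) (twoSinHalf-odd j) ⟨
  (- ¼) * twoSinHalf (suc (2 ℕ.* j)) ∎

cosHalf²+¼twoSinHalf²≈𝟙 : cosHalf ⊛ cosHalf ⊕ ¼ · (twoSinHalf ⊛ twoSinHalf) ≈ 𝟙
cosHalf²+¼twoSinHalf²≈𝟙 = D≈𝟘⇒≈𝟙 _ derivative-vanishes refl
  where
  s = twoSinHalf
  c = cosHalf
  derivative-vanishes : D (c ⊛ c ⊕ ¼ · (s ⊛ s)) ≈ 𝟘
  derivative-vanishes n = begin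
    D (c ⊛ c ⊕ ¼ · (s ⊛ s)) n
      ≡⟨ D-⊕ (c ⊛ c) (¼ · (s ⊛ s)) n ⟩
    D (c ⊛ c) n + D (¼ · (s ⊛ s)) n
      ≡⟨ cong₂ _+_ (D-⊛ c c n) (trans (D-· ¼ (s ⊛ s) n) (cong (¼ *_) (D-⊛ s s n))) ⟩
    ((D c ⊛ c) n + (c ⊛ D c) n) + ¼ * ((c ⊛ s) n + (s ⊛ c) n)
      ≡⟨ cong (_+ ¼ * ((c ⊛ s) n + (s ⊛ c) n))
              (cong₂ _+_ (trans (⊛-congʳ c D-cosHalf n) (⊛-·ˡ (- ¼) s c n))
                         (trans (⊛-congˡ c D-cosHalf n) (⊛-·ʳ (- ¼) c s n))) ⟩
    ((- ¼) * (s ⊛ c) n + (- ¼) * (c ⊛ s) n) + ¼ * ((c ⊛ s) n + (s ⊛ c) n)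
      ≡⟨ solve 3 (λ q x y → ((:- q) :* x :+ (:- q) :* y) :+ q :* (y :+ x) := con 0ℚ) refl ¼ ((s ⊛ c) n) ((c ⊛ s) n) ⟩
    0ℚ ∎

cosHalf² : cosHalf ⊛ cosHalf ≈ 𝟙 ⊕ (- ¼) · (twoSinHalf ⊛ twoSinHalf)
cosHalf² n = begin
  (c ⊛ c) n                                     ≡⟨ solve 3 (λ x q y → x := (x :+ q :* y) :+ (:- q) :* y) refl ((c ⊛ c) n) ¼ ((s ⊛ s) n) ⟩
  ((c ⊛ c) n + ¼ * (s ⊛ s) n) + (- ¼) * (s ⊛ s) n ≡⟨ cong (_+ (- ¼) * (s ⊛ s) n) (cosHalf²+¼twoSinHalf²≈𝟙 n) ⟩
  𝟙 n + (- ¼) * (s ⊛ s) n                       ∎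
  where
  s = twoSinHalf
  c = cosHalf

D²-twoSinHalf^S : ∀ j → D (D (twoSinHalf ^S suc (suc j))) ≈
  ⟦ suc (suc j) ⟧ · (⟦ suc j ⟧ · (twoSinHalf ^S j) ⊕ (- ¼) · (⟦ suc (suc j) ⟧ · (twoSinHalf ^S suc (suc j))))
D²-twoSinHalf^S j n = begin
  D (D (u (suc (suc j)))) n                                ≡⟨ D-cong (D-^S s (suc j)) n ⟩
  D (J2 · (u (suc j) ⊛ c)) n                               ≡⟨ D-· J2 (u (suc j) ⊛ c) n ⟩
  J2 * D (u (suc j) ⊛ c) n                                 ≡⟨ cong (J2 *_) (D-⊛ (u (suc j)) c n) ⟩
  J2 * ((D (u (suc j)) ⊛ c) n + (u (suc j) ⊛ D c) n)       ≡⟨ cong (J2 *_) (cong₂ _+_ first second) ⟩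
  J2 * (J1 * (u j n + (- ¼) * W) + (- ¼) * W)              ≡⟨ cong (λ x → x * (J1 * (u j n + (- ¼) * W) + (- ¼) * W)) (⟦⟧-suc (suc j)) ⟩
  (1ℚ + J1) * (J1 * (u j n + (- ¼) * W) + (- ¼) * W)       ≡⟨ regroup J1 (u j n) ¼ W ⟩
  (1ℚ + J1) * (J1 * u j n + (- ¼) * ((1ℚ + J1) * W))       ≡⟨ cong (λ x → x * (J1 * u j n + (- ¼) * (x * W))) (⟦⟧-suc (suc j)) ⟨
  J2 * (J1 * u j n + (- ¼) * (J2 * W))                     ∎
  where
  s = twoSinHalf
  c = cosHalf
  u : ℕ → Series
  u i = s ^S i
  J1 = ⟦ suc j ⟧
  J2 = ⟦ suc (suc j) ⟧
  W = u (suc (suc j)) n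
  first : (D (u (suc j)) ⊛ c) n ≡ J1 * (u j n + (- ¼) * W)
  first = begin
    (D (u (suc j)) ⊛ c) n                     ≡⟨ ⊛-congʳ c (D-^S s j) n ⟩
    ((J1 · (u j ⊛ c)) ⊛ c) n                  ≡⟨ ⊛-·ˡ J1 (u j ⊛ c) c n ⟩
    J1 * ((u j ⊛ c) ⊛ c) n                    ≡⟨ cong (J1 *_) (⊛-assoc (u j) c c n) ⟩
    J1 * (u j ⊛ (c ⊛ c)) n                    ≡⟨ cong (J1 *_) (⊛-congˡ (u j) cosHalf² n) ⟩
    J1 * (u j ⊛ (𝟙 ⊕ (- ¼) · (s ⊛ s))) n      ≡⟨ cong (J1 *_) (⊛-distribˡ-⊕ (u j) 𝟙 ((- ¼) · (s ⊛ s)) n) ⟩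
    J1 * ((u j ⊛ 𝟙) n + (u j ⊛ ((- ¼) · (s ⊛ s))) n)
      ≡⟨ cong (J1 *_) (cong₂ _+_ (⊛-identityʳ (u j) n)
                                 (trans (⊛-·ʳ (- ¼) (u j) (s ⊛ s) n) (cong ((- ¼) *_) (u∙s∙s n)))) ⟩
    J1 * (u j n + (- ¼) * W) ∎
    where
    u∙s∙s : u j ⊛ (s ⊛ s) ≈ u (suc (suc j))
    u∙s∙s = ≈-trans (⊛-comm (u j) (s ⊛ s)) (⊛-assoc s s (u j))
  second : (u (suc j) ⊛ D c) n ≡ (- ¼) * W
  second = begin
    (u (suc j) ⊛ D c) n          ≡⟨ ⊛-congˡ (u (suc j)) D-cosHalf n ⟩
    (u (suc j) ⊛ ((- ¼) · s)) n  ≡⟨ ⊛-·ʳ (- ¼) (u (suc j)) s n ⟩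
    (- ¼) * (u (suc j) ⊛ s) n    ≡⟨ cong ((- ¼) *_) (⊛-comm (u (suc j)) s n) ⟩
    (- ¼) * W                    ∎
  regroup : ∀ a x q w → (1ℚ + a) * (a * (x + (- q) * w) + (- q) * w) ≡ (1ℚ + a) * (a * x + (- q) * ((1ℚ + a) * w))
  regroup = solve 4 (λ a x q w → (con 1ℚ :+ a) :* (a :* (x :+ (:- q) :* w) :+ (:- q) :* w)
                        := (con 1ℚ :+ a) :* (a :* x :+ (:- q) :* ((con 1ℚ :+ a) :* w))) refl

twoSinHalf^S-odd : ∀ n i → (twoSinHalf ^S (2 ℕ.* i)) (suc (2 ℕ.* n)) ≡ 0ℚ
twoSinHalf^S-odd zero zero = refl
twoSinHalf^S-odd zero (suc i) =
  subst (λ J → (twoSinHalf ^S J) 1 ≡ 0ℚ) (sym (2*suc i)) (^S-2+-at-1 twoSinHalf refl (2 ℕ.* i))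
twoSinHalf^S-odd (suc n) zero = refl
twoSinHalf^S-odd (suc n) (suc i) =
  subst₂ (λ J M → u J (suc M) ≡ 0ℚ) (sym (2*suc i)) (sym (2*suc n))
    (⟦⟧*x≡0⇒x≡0 (suc (suc (suc N))) _ (⟦⟧*x≡0⇒x≡0 (suc (suc N)) _ (begin
      ⟦ suc (suc N) ⟧ * (⟦ suc (suc (suc N)) ⟧ * u (suc (suc j)) (suc (suc (suc N))))
        ≡⟨ D²-twoSinHalf^S j (suc N) ⟩
      ⟦ suc (suc j) ⟧ * (⟦ suc j ⟧ * u j (suc N) + (- ¼) * (⟦ suc (suc j) ⟧ * u (suc (suc j)) (suc N)))
        ≡⟨ cong₂ (λ x y → ⟦ suc (suc j) ⟧ * (⟦ suc j ⟧ * x + (- ¼) * (⟦ suc (suc j) ⟧ * y)))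
                 (twoSinHalf^S-odd n i)
                 (trans (cong (λ J → u J (suc N)) (sym (2*suc i))) (twoSinHalf^S-odd n (suc i))) ⟩
      ⟦ suc (suc j) ⟧ * (⟦ suc j ⟧ * 0ℚ + (- ¼) * (⟦ suc (suc j) ⟧ * 0ℚ))
        ≡⟨ solve 3 (λ a b q → a :* (b :* con 0ℚ :+ (:- q) :* (a :* con 0ℚ)) := con 0ℚ) refl ⟦ suc (suc j) ⟧ ⟦ suc j ⟧ ¼ ⟩
      0ℚ ∎)))
  where
  u : ℕ → Series
  u i = twoSinHalf ^S i
  j = 2 ℕ.* i
  N = 2 ℕ.* n

signedStirling2₂ : ℕ → ℕ → ℚ
signedStirling2₂ zero zero = 1ℚ
signedStirling2₂ zero (suc k) = 0ℚ
signedStirling2₂ (suc n) zero = 0ℚ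
signedStirling2₂ (suc n) (suc k) = signedStirling2₂ n k + (- ⟦ suc k ℕ.* suc k ⟧) * signedStirling2₂ n (suc k)

twoSinHalf^S-even : ∀ n i →
  (twoSinHalf ^S (2 ℕ.* i)) (2 ℕ.* n) * ⟦ (2 ℕ.* n) ! ⟧ ≡ ⟦ (2 ℕ.* i) ! ⟧ * signedStirling2₂ n i
twoSinHalf^S-even zero zero = refl
twoSinHalf^S-even zero (suc i) =
  subst (λ J → (twoSinHalf ^S J) 0 * ⟦ 1 ⟧ ≡ ⟦ J ! ⟧ * 0ℚ) (sym (2*suc i))
    (trans (cong (_* ⟦ 1 ⟧) (^S-suc-at-0 twoSinHalf refl (suc (2 ℕ.* i))))
           (trans (QP.*-zeroˡ ⟦ 1 ⟧) (sym (QP.*-zeroʳ ⟦ suc (suc (2 ℕ.* i)) ! ⟧))))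
twoSinHalf^S-even (suc n) zero = trans (QP.*-zeroˡ ⟦ (2 ℕ.* suc n) ! ⟧) (sym (QP.*-zeroʳ ⟦ 1 ⟧))
twoSinHalf^S-even (suc n) (suc i) =
  subst₂ (λ J M → u J M * ⟦ M ! ⟧ ≡ ⟦ J ! ⟧ * signedStirling2₂ (suc n) (suc i)) (sym (2*suc i)) (sym (2*suc n)) (begin
    W2 * ⟦ suc (suc N) ! ⟧
      ≡⟨ cong (W2 *_) (⟦⟧-!-suc² N) ⟩
    W2 * (⟦ suc (suc N) ⟧ * (⟦ suc N ⟧ * ⟦ N ! ⟧))
      ≡⟨ solve 4 (λ w a b f → w :* (a :* (b :* f)) := (b :* (a :* w)) :* f) refl W2 ⟦ suc (suc N) ⟧ ⟦ suc N ⟧ ⟦ N ! ⟧ ⟩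
    (⟦ suc N ⟧ * (⟦ suc (suc N) ⟧ * W2)) * ⟦ N ! ⟧
      ≡⟨ cong (_* ⟦ N ! ⟧) (D²-twoSinHalf^S j N) ⟩
    (J2 * (J1 * u j N + (- ¼) * (J2 * u (suc (suc j)) N))) * ⟦ N ! ⟧
      ≡⟨ solve 6 (λ a b x q y f → (a :* (b :* x :+ (:- q) :* (a :* y))) :* f := a :* (b :* (x :* f) :+ (:- q) :* (a :* (y :* f))))
               refl J2 J1 (u j N) ¼ (u (suc (suc j)) N) ⟦ N ! ⟧ ⟩
    J2 * (J1 * (u j N * ⟦ N ! ⟧) + (- ¼) * (J2 * (u (suc (suc j)) N * ⟦ N ! ⟧)))
      ≡⟨ cong₂ (λ p q → J2 * (J1 * p + (- ¼) * (J2 * q))) (twoSinHalf^S-even n i)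
               (subst (λ J → u J N * ⟦ N ! ⟧ ≡ ⟦ J ! ⟧ * y) (2*suc i) (twoSinHalf^S-even n (suc i))) ⟩
    J2 * (J1 * (F * x) + (- ¼) * (J2 * (G * y)))
      ≡⟨ solve 7 (λ a b f x q g y → a :* (b :* (f :* x) :+ (:- q) :* (a :* (g :* y))) := (a :* (b :* f)) :* x :+ (:- (q :* (a :* a))) :* (g :* y))
               refl J2 J1 F x ¼ G y ⟩
    (J2 * (J1 * F)) * x + (- (¼ * (J2 * J2))) * (G * y)
      ≡⟨ cong₂ (λ p q → p * x + (- q) * (G * y)) (sym (⟦⟧-!-suc² j)) (¼*⟦2+2m⟧²≡⟦1+m⟧² i) ⟩
    G * x + (- ⟦ suc i ℕ.* suc i ⟧) * (G * y)
      ≡⟨ solve 4 (λ g x k y → g :* x :+ (:- k) :* (g :* y) := g :* (x :+ (:- k) :* y)) refl G x ⟦ suc i ℕ.* suc i ⟧ y ⟩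
    G * signedStirling2₂ (suc n) (suc i) ∎)
  where
  u : ℕ → Series
  u i = twoSinHalf ^S i
  j = 2 ℕ.* i
  N = 2 ℕ.* n
  W2 = u (suc (suc j)) (suc (suc N))
  J1 = ⟦ suc j ⟧
  J2 = ⟦ suc (suc j) ⟧
  F = ⟦ j ! ⟧
  G = ⟦ suc (suc j) ! ⟧
  x = signedStirling2₂ n i
  y = signedStirling2₂ n (suc i)

arcsinhCoeff : ℕ → ℚ
arcsinhCoeff j = sgn j * ⟦ (2 ℕ.* j) ! ⟧ * inv4^ j * inv! j * inv! j * inv (suc (2 ℕ.* j))

arcsinh-even : ∀ j → arcsinh (2 ℕ.* j) ≡ 0ℚ
arcsinh-even = oddSeries-even _

arcsinh-odd : ∀ j → arcsinh (suc (2 ℕ.* j)) ≡ arcsinhCoeff j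
arcsinh-odd = oddSeries-odd _

arcsinhCoeff-suc : ∀ k → ⟦ suc (suc (2 ℕ.* k)) ⟧ * (⟦ suc (suc (suc (2 ℕ.* k))) ⟧ * arcsinhCoeff (suc k))
                         ≡ - (⟦ suc (2 ℕ.* k) ⟧ * (⟦ suc (2 ℕ.* k) ⟧ * arcsinhCoeff k))
arcsinhCoeff-suc k = begin
  ⟦ b₂ ⟧ * (⟦ b₃ ⟧ * arcsinhCoeff (suc k))
    ≡⟨ cong₂ (λ x y → x * (⟦ b₃ ⟧ * y)) (⟦⟧-2*suc k) expand ⟩
  (T * K) * (⟦ b₃ ⟧ * ((((((- g) * ((T * K) * (B * F))) * (¼ * P)) * (iK * iF)) * (iK * iF)) * inv b₃))
    ≡⟨ solve 11 (λ g F P iF T K iK q B iB₃ B₃ →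
                   (T :* K) :* (B₃ :* ((((((:- g) :* ((T :* K) :* (B :* F))) :* (q :* P)) :* (iK :* iF)) :* (iK :* iF)) :* iB₃))
                   := (:- (g :* F :* P :* iF :* iF :* B)) :* ((T :* T :* q) :* (K :* iK) :* (K :* iK) :* (B₃ :* iB₃)))
               refl g F P iF T K iK ¼ B (inv b₃) ⟦ b₃ ⟧ ⟩
  c * ((T * T * ¼) * (K * iK) * (K * iK) * (⟦ b₃ ⟧ * inv b₃))
    ≡⟨ cong (λ z → c * z) (cong₂ (λ x y → 1ℚ * x * x * y) (inv-inverseʳ (suc k)) (inv-inverseʳ b₃)) ⟩
  c * 1ℚ
    ≡⟨ cong (c *_) (inv-inverseʳ b₁) ⟨
  c * (B * inv b₁)
    ≡⟨ solve 6 (λ g F P iF B iB → (:- (g :* F :* P :* iF :* iF :* B)) :* (B :* iB)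
                                   := :- (B :* (B :* (g :* F :* P :* iF :* iF :* iB)))) refl g F P iF B (inv b₁) ⟩
  - (B * (B * arcsinhCoeff k)) ∎
  where
  b₁ = suc (2 ℕ.* k)
  b₂ = suc b₁
  b₃ = suc b₂
  g = sgn k
  F = ⟦ (2 ℕ.* k) ! ⟧
  P = inv4^ k
  iF = inv! k
  T = ⟦ 2 ⟧
  K = ⟦ suc k ⟧
  iK = inv (suc k)
  B = ⟦ b₁ ⟧
  c = - (g * F * P * iF * iF * B)
  expand : arcsinhCoeff (suc k) ≡ (((((- g) * ((T * K) * (B * F))) * (¼ * P)) * (iK * iF)) * (iK * iF)) * inv b₃
  expand = begin
    ((((- g) * ⟦ (2 ℕ.* suc k) ! ⟧) * inv4^ (suc k)) * inv! (suc k) * inv! (suc k)) * inv (suc (2 ℕ.* suc k))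
      ≡⟨ cong (λ m → ((((- g) * ⟦ m ! ⟧) * inv4^ (suc k)) * inv! (suc k) * inv! (suc k)) * inv (suc m)) (2*suc k) ⟩
    ((((- g) * ⟦ b₂ ! ⟧) * inv4^ (suc k)) * inv! (suc k) * inv! (suc k)) * inv b₃
      ≡⟨ cong₂ (λ x y → ((((- g) * x) * y) * inv! (suc k) * inv! (suc k)) * inv b₃)
               (trans (⟦⟧-!-suc² (2 ℕ.* k)) (cong (_* (B * F)) (⟦⟧-2*suc k))) (inv4^-suc k) ⟩
    ((((- g) * ((T * K) * (B * F))) * (¼ * P)) * inv! (suc k) * inv! (suc k)) * inv b₃
      ≡⟨ cong (λ z → ((((- g) * ((T * K) * (B * F))) * (¼ * P)) * z * z) * inv b₃) (inv!-suc k) ⟩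
    (((((- g) * ((T * K) * (B * F))) * (¼ * P)) * (iK * iF)) * (iK * iF)) * inv b₃ ∎

arcsinh′ : Series
arcsinh′ = D arcsinh

arcsinh′-ode : D arcsinh′ ⊕ X² (D arcsinh′) ⊕ X arcsinh′ ≈ 𝟘
arcsinh′-ode zero = refl
arcsinh′-ode (suc zero) = refl
arcsinh′-ode (suc (suc m)) with parity m
... | even j = begin
  (A₃ * (A₄ * a (suc (suc (suc (suc (2 ℕ.* j)))))) + A₁ * (A₂ * a (suc (suc (2 ℕ.* j))))) + A₂ * a (suc (suc (2 ℕ.* j)))
    ≡⟨ cong₂ (λ x y → (A₃ * (A₄ * x) + A₁ * (A₂ * y)) + A₂ * y)
             (trans (cong (λ z → a (suc (suc z))) (sym (2*suc j))) (trans (cong a (sym (2*suc (suc j)))) (arcsinh-even (suc (suc j)))))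
             (trans (cong a (sym (2*suc j))) (arcsinh-even (suc j))) ⟩
  (A₃ * (A₄ * 0ℚ) + A₁ * (A₂ * 0ℚ)) + A₂ * 0ℚ
    ≡⟨ solve 4 (λ A₁ A₂ A₃ A₄ → (A₃ :* (A₄ :* con 0ℚ) :+ A₁ :* (A₂ :* con 0ℚ)) :+ A₂ :* con 0ℚ := con 0ℚ) refl A₁ A₂ A₃ A₄ ⟩
  0ℚ ∎
  where
  a = arcsinh
  A₁ = ⟦ suc (2 ℕ.* j) ⟧
  A₂ = ⟦ suc (suc (2 ℕ.* j)) ⟧
  A₃ = ⟦ suc (suc (suc (2 ℕ.* j))) ⟧
  A₄ = ⟦ suc (suc (suc (suc (2 ℕ.* j)))) ⟧
... | odd j = subst coefficient-vanishes (2*suc j) (odd-coefficient (suc j))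
  where
  coefficient-vanishes : ℕ → Set
  coefficient-vanishes x = (⟦ suc (suc x) ⟧ * (⟦ suc (suc (suc x)) ⟧ * arcsinh (suc (suc (suc x))))
                           + ⟦ x ⟧ * (⟦ suc x ⟧ * arcsinh (suc x))) + ⟦ suc x ⟧ * arcsinh (suc x) ≡ 0ℚ
  odd-coefficient : ∀ k → coefficient-vanishes (2 ℕ.* k)
  odd-coefficient k = begin
    (⟦ suc (suc (2 ℕ.* k)) ⟧ * (⟦ suc (suc (suc (2 ℕ.* k))) ⟧ * arcsinh (suc (suc (suc (2 ℕ.* k)))))
      + B₀ * (B₁ * arcsinh (suc (2 ℕ.* k)))) + B₁ * arcsinh (suc (2 ℕ.* k))
      ≡⟨ cong₂ (λ x y → (⟦ suc (suc (2 ℕ.* k)) ⟧ * (⟦ suc (suc (suc (2 ℕ.* k))) ⟧ * x) + B₀ * (B₁ * y)) + B₁ * y)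
               (trans (cong (λ z → arcsinh (suc z)) (sym (2*suc k))) (arcsinh-odd (suc k))) (arcsinh-odd k) ⟩
    (⟦ suc (suc (2 ℕ.* k)) ⟧ * (⟦ suc (suc (suc (2 ℕ.* k))) ⟧ * arcsinhCoeff (suc k)) + B₀ * (B₁ * c)) + B₁ * c
      ≡⟨ cong (λ z → (z + B₀ * (B₁ * c)) + B₁ * c) (arcsinhCoeff-suc k) ⟩
    (- (B₁ * (B₁ * c)) + B₀ * (B₁ * c)) + B₁ * c
      ≡⟨ cong (λ b → (- (b * (b * c)) + B₀ * (b * c)) + b * c) (⟦⟧-suc (2 ℕ.* k)) ⟩
    (- ((1ℚ + B₀) * ((1ℚ + B₀) * c)) + B₀ * ((1ℚ + B₀) * c)) + (1ℚ + B₀) * c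
      ≡⟨ solve 2 (λ b x → (:- ((con 1ℚ :+ b) :* ((con 1ℚ :+ b) :* x)) :+ b :* ((con 1ℚ :+ b) :* x)) :+ (con 1ℚ :+ b) :* x
                          := con 0ℚ) refl B₀ c ⟩
    0ℚ ∎
    where
    B₀ = ⟦ 2 ℕ.* k ⟧
    B₁ = ⟦ suc (2 ℕ.* k) ⟧
    c = arcsinhCoeff k

arcsinh′²-identity : arcsinh′ ⊛ arcsinh′ ⊕ X² (arcsinh′ ⊛ arcsinh′) ≈ 𝟙
arcsinh′²-identity = D≈𝟘⇒≈𝟙 _ derivative-vanishes refl
  where
  r = arcsinh′
  ρ = r ⊛ r
  ψ = r ⊛ D r
  Dρ : D ρ ≈ ψ ⊕ ψ
  Dρ m = trans (D-⊛ r r m) (cong (_+ ψ m) (⊛-comm (D r) r m))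
  derivative-vanishes : D (ρ ⊕ X² ρ) ≈ 𝟘
  derivative-vanishes n = begin
    D (ρ ⊕ X² ρ) n
      ≡⟨ D-⊕ ρ (X² ρ) n ⟩
    D ρ n + D (X² ρ) n
      ≡⟨ cong (D ρ n +_) (D-X (X ρ) n) ⟩
    D ρ n + (X ρ n + X (D (X ρ)) n)
      ≡⟨ cong (λ z → D ρ n + (X ρ n + z)) (trans (X-cong (D-X ρ) n) (X-⊕ ρ (X (D ρ)) n)) ⟩
    D ρ n + (X ρ n + (X ρ n + X² (D ρ) n))
      ≡⟨ cong₂ (λ x y → x + (X ρ n + (X ρ n + y))) (Dρ n) (trans (X-cong (X-cong Dρ) n) (X²-⊕ ψ ψ n)) ⟩
    (ψ n + ψ n) + (X ρ n + (X ρ n + (X² ψ n + X² ψ n)))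
      ≡⟨ cong₂ (λ x y → (ψ n + ψ n) + (x + (x + (y + y)))) (sym (⊛-X r r n)) (sym (⊛-X² r (D r) n)) ⟩
    (ψ n + ψ n) + (ρx + (ρx + (χ + χ)))
      ≡⟨ solve 3 (λ p x c → (p :+ p) :+ (x :+ (x :+ (c :+ c))) := (p :+ c :+ x) :+ (p :+ c :+ x)) refl (ψ n) ρx χ ⟩
    (ψ n + χ + ρx) + (ψ n + χ + ρx)
      ≡⟨ cong (λ z → z + z) (sym r⊛ode) ⟩
    (r ⊛ (D r ⊕ X² (D r) ⊕ X r)) n + (r ⊛ (D r ⊕ X² (D r) ⊕ X r)) n
      ≡⟨ cong (λ z → z + z) (⊛-zeroʳ r arcsinh′-ode n) ⟩
    0ℚ ∎
    where
    ρx = (r ⊛ X r) n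
    χ = (r ⊛ X² (D r)) n
    r⊛ode : (r ⊛ (D r ⊕ X² (D r) ⊕ X r)) n ≡ ψ n + χ + ρx
    r⊛ode = trans (⊛-distribˡ-⊕ r (D r ⊕ X² (D r)) (X r) n) (cong (_+ ρx) (⊛-distribˡ-⊕ r (D r) (X² (D r)) n))

arcsinh^S-ode : ∀ j → let V = arcsinh ^S suc (suc j) in
  D (D V) ⊕ X² (D (D V)) ⊕ X (D V) ≈ ⟦ suc (suc j) ⟧ · (⟦ suc j ⟧ · (arcsinh ^S j))
arcsinh^S-ode j n = begin
  (D (D V) n + X² (D (D V)) n) + X (D V) n
    ≡⟨ cong₂ (λ x y → x + y) (cong₂ _+_ (D²V n) (trans (X-cong (X-cong D²V) n) (X²-· J2 Y n)))
                             (trans (X-cong (D-^S a (suc j)) n) (X-· J2 _ n)) ⟩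
  (J2 * Y n + J2 * X² Y n) + J2 * X (v₁ ⊛ r) n
    ≡⟨ cong₂ (λ x y → (J2 * Y n + J2 * x) + J2 * y) X²Y (sym (⊛-X v₁ r n)) ⟩
  (J2 * (J1 * (v₀ ⊛ ρ) n + (v₁ ⊛ D r) n) + J2 * (J1 * (v₀ ⊛ X² ρ) n + (v₁ ⊛ X² (D r)) n)) + J2 * (v₁ ⊛ X r) n
    ≡⟨ solve 7 (λ J2 J1 p q p′ q′ w → (J2 :* (J1 :* p :+ q) :+ J2 :* (J1 :* p′ :+ q′)) :+ J2 :* w
                                       := J2 :* (J1 :* (p :+ p′) :+ ((q :+ q′) :+ w)))
               refl J2 J1 ((v₀ ⊛ ρ) n) ((v₁ ⊛ D r) n) ((v₀ ⊛ X² ρ) n) ((v₁ ⊛ X² (D r)) n) ((v₁ ⊛ X r) n) ⟩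
  J2 * (J1 * ((v₀ ⊛ ρ) n + (v₀ ⊛ X² ρ) n) + (((v₁ ⊛ D r) n + (v₁ ⊛ X² (D r)) n) + (v₁ ⊛ X r) n))
    ≡⟨ cong₂ (λ x y → J2 * (J1 * x + y)) v₀⊛identity v₁⊛ode ⟩
  J2 * (J1 * v₀ n + 0ℚ)
    ≡⟨ cong (J2 *_) (QP.+-identityʳ _) ⟩
  J2 * (J1 * v₀ n) ∎
  where
  a = arcsinh
  r = arcsinh′
  ρ = r ⊛ r
  V = a ^S suc (suc j)
  v₀ = a ^S j
  v₁ = a ^S suc j
  J1 = ⟦ suc j ⟧
  J2 = ⟦ suc (suc j) ⟧
  Y = J1 · (v₀ ⊛ ρ) ⊕ v₁ ⊛ D r
  D²V : D (D V) ≈ J2 · Y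
  D²V m = begin
    D (D V) m                              ≡⟨ D-cong (D-^S a (suc j)) m ⟩
    D (J2 · (v₁ ⊛ r)) m                    ≡⟨ D-· J2 (v₁ ⊛ r) m ⟩
    J2 * D (v₁ ⊛ r) m                      ≡⟨ cong (J2 *_) (D-⊛ v₁ r m) ⟩
    J2 * ((D v₁ ⊛ r) m + (v₁ ⊛ D r) m)
      ≡⟨ cong (λ x → J2 * (x + (v₁ ⊛ D r) m))
              (trans (⊛-congʳ r (D-^S a j) m) (trans (⊛-·ˡ J1 (v₀ ⊛ r) r m) (cong (J1 *_) (⊛-assoc v₀ r r m)))) ⟩
    J2 * Y m ∎
  X²Y : X² Y n ≡ J1 * (v₀ ⊛ X² ρ) n + (v₁ ⊛ X² (D r)) n
  X²Y = trans (X²-⊕ (J1 · (v₀ ⊛ ρ)) (v₁ ⊛ D r) n)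
              (cong₂ _+_ (trans (X²-· J1 (v₀ ⊛ ρ) n) (cong (J1 *_) (sym (⊛-X² v₀ ρ n)))) (sym (⊛-X² v₁ (D r) n)))
  v₀⊛identity : (v₀ ⊛ ρ) n + (v₀ ⊛ X² ρ) n ≡ v₀ n
  v₀⊛identity = trans (sym (⊛-distribˡ-⊕ v₀ ρ (X² ρ) n)) (trans (⊛-congˡ v₀ arcsinh′²-identity n) (⊛-identityʳ v₀ n))
  v₁⊛ode : ((v₁ ⊛ D r) n + (v₁ ⊛ X² (D r)) n) + (v₁ ⊛ X r) n ≡ 0ℚ
  v₁⊛ode = trans (sym (trans (⊛-distribˡ-⊕ v₁ (D r ⊕ X² (D r)) (X r) n)
                             (cong (_+ (v₁ ⊛ X r) n) (⊛-distribˡ-⊕ v₁ (D r) (X² (D r)) n))))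
                 (⊛-zeroʳ v₁ arcsinh′-ode n)

-- x² f″ + x f′ = (x d/dx)² f, which acts on x^N as multiplication by N²
X²D²⊕XD-coeff : ∀ f N → X² (D (D f)) N + X (D f) N ≡ ⟦ N ⟧ * (⟦ N ⟧ * f N)
X²D²⊕XD-coeff f zero = trans (QP.+-identityˡ 0ℚ) (sym (QP.*-zeroˡ (⟦ 0 ⟧ * f 0)))
X²D²⊕XD-coeff f (suc zero) = trans (QP.+-identityˡ (⟦ 1 ⟧ * f 1)) (cong (⟦ 1 ⟧ *_) (sym (QP.*-identityˡ (f 1))))
X²D²⊕XD-coeff f (suc (suc m)) = begin
  ⟦ suc m ⟧ * (⟦ suc (suc m) ⟧ * x) + ⟦ suc (suc m) ⟧ * x
    ≡⟨ cong (λ b → ⟦ suc m ⟧ * (b * x) + b * x) (⟦⟧-suc (suc m)) ⟩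
  ⟦ suc m ⟧ * ((1ℚ + ⟦ suc m ⟧) * x) + (1ℚ + ⟦ suc m ⟧) * x
    ≡⟨ solve 2 (λ b x → b :* ((con 1ℚ :+ b) :* x) :+ (con 1ℚ :+ b) :* x := (con 1ℚ :+ b) :* ((con 1ℚ :+ b) :* x)) refl ⟦ suc m ⟧ x ⟩
  (1ℚ + ⟦ suc m ⟧) * ((1ℚ + ⟦ suc m ⟧) * x)
    ≡⟨ cong (λ b → b * (b * x)) (⟦⟧-suc (suc m)) ⟨
  ⟦ suc (suc m) ⟧ * (⟦ suc (suc m) ⟧ * x) ∎
  where
  x = f (suc (suc m))

arcsinh^S-recurrence : ∀ j N →
  ⟦ suc N ⟧ * (⟦ suc (suc N) ⟧ * (arcsinh ^S suc (suc j)) (suc (suc N))) + ⟦ N ⟧ * (⟦ N ⟧ * (arcsinh ^S suc (suc j)) N)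
  ≡ ⟦ suc (suc j) ⟧ * (⟦ suc j ⟧ * (arcsinh ^S j) N)
arcsinh^S-recurrence j N = begin
  D (D V) N + ⟦ N ⟧ * (⟦ N ⟧ * V N)               ≡⟨ cong (D (D V) N +_) (X²D²⊕XD-coeff V N) ⟨
  D (D V) N + (X² (D (D V)) N + X (D V) N)        ≡⟨ QP.+-assoc (D (D V) N) _ _ ⟨
  (D (D V) N + X² (D (D V)) N) + X (D V) N        ≡⟨ arcsinh^S-ode j N ⟩
  ⟦ suc (suc j) ⟧ * (⟦ suc j ⟧ * (arcsinh ^S j) N) ∎
  where
  V = arcsinh ^S suc (suc j)

signedStirling1₂ : ℕ → ℕ → ℚ
signedStirling1₂ zero zero = 1ℚ
signedStirling1₂ zero (suc i) = 0ℚ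
signedStirling1₂ (suc l) zero = 0ℚ
signedStirling1₂ (suc l) (suc i) = signedStirling1₂ l i + (- ⟦ l ℕ.* l ⟧) * signedStirling1₂ l (suc i)

arcsinh^S-odd : ∀ l i → (arcsinh ^S (2 ℕ.* i)) (suc (2 ℕ.* l)) ≡ 0ℚ
arcsinh^S-odd zero zero = refl
arcsinh^S-odd zero (suc i) =
  subst (λ J → (arcsinh ^S J) 1 ≡ 0ℚ) (sym (2*suc i)) (^S-2+-at-1 arcsinh refl (2 ℕ.* i))
arcsinh^S-odd (suc l) zero = refl
arcsinh^S-odd (suc l) (suc i) =
  subst₂ (λ J M → v J (suc M) ≡ 0ℚ) (sym (2*suc i)) (sym (2*suc l))
    (⟦⟧*x≡0⇒x≡0 (suc (suc (suc N))) _ (⟦⟧*x≡0⇒x≡0 (suc (suc N)) _ (begin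
      ⟦ suc (suc N) ⟧ * (⟦ suc (suc (suc N)) ⟧ * V (suc (suc (suc N))))
        ≡⟨ QP.+-identityʳ _ ⟨
      ⟦ suc (suc N) ⟧ * (⟦ suc (suc (suc N)) ⟧ * V (suc (suc (suc N)))) + 0ℚ
        ≡⟨ cong (⟦ suc (suc N) ⟧ * (⟦ suc (suc (suc N)) ⟧ * V (suc (suc (suc N)))) +_) (sym lower-vanishes) ⟩
      ⟦ suc (suc N) ⟧ * (⟦ suc (suc (suc N)) ⟧ * V (suc (suc (suc N)))) + ⟦ suc N ⟧ * (⟦ suc N ⟧ * V (suc N))
        ≡⟨ arcsinh^S-recurrence j (suc N) ⟩
      ⟦ suc (suc j) ⟧ * (⟦ suc j ⟧ * v j (suc N))
        ≡⟨ cong (λ x → ⟦ suc (suc j) ⟧ * (⟦ suc j ⟧ * x)) (arcsinh^S-odd l i) ⟩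
      ⟦ suc (suc j) ⟧ * (⟦ suc j ⟧ * 0ℚ)
        ≡⟨ solve 2 (λ a b → a :* (b :* con 0ℚ) := con 0ℚ) refl ⟦ suc (suc j) ⟧ ⟦ suc j ⟧ ⟩
      0ℚ ∎)))
  where
  v : ℕ → Series
  v i = arcsinh ^S i
  j = 2 ℕ.* i
  N = 2 ℕ.* l
  V = v (suc (suc j))
  lower-vanishes : ⟦ suc N ⟧ * (⟦ suc N ⟧ * V (suc N)) ≡ 0ℚ
  lower-vanishes = begin
    ⟦ suc N ⟧ * (⟦ suc N ⟧ * V (suc N)) ≡⟨ cong (λ x → ⟦ suc N ⟧ * (⟦ suc N ⟧ * x))
                                                (subst (λ J → v J (suc N) ≡ 0ℚ) (2*suc i) (arcsinh^S-odd l (suc i))) ⟩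
    ⟦ suc N ⟧ * (⟦ suc N ⟧ * 0ℚ)        ≡⟨ solve 1 (λ a → a :* (a :* con 0ℚ) := con 0ℚ) refl ⟦ suc N ⟧ ⟩
    0ℚ                                  ∎

arcsinh^S-even : ∀ l i → (arcsinh ^S (2 ℕ.* i)) (2 ℕ.* l) * ⟦ (2 ℕ.* l) ! ⟧ * ⟦ 4 ℕ.^ i ⟧
                         ≡ ⟦ (2 ℕ.* i) ! ⟧ * ⟦ 4 ℕ.^ l ⟧ * signedStirling1₂ l i
arcsinh^S-even zero zero = refl
arcsinh^S-even zero (suc i) =
  subst (λ J → (arcsinh ^S J) 0 * ⟦ 1 ⟧ * ⟦ 4 ℕ.^ suc i ⟧ ≡ ⟦ J ! ⟧ * ⟦ 1 ⟧ * 0ℚ) (sym (2*suc i))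
    (trans (cong (λ x → x * ⟦ 1 ⟧ * ⟦ 4 ℕ.^ suc i ⟧) (^S-suc-at-0 arcsinh refl (suc (2 ℕ.* i))))
           (solve 3 (λ a b c → con 0ℚ :* a :* b := c :* a :* con 0ℚ) refl ⟦ 1 ⟧ ⟦ 4 ℕ.^ suc i ⟧ ⟦ suc (suc (2 ℕ.* i)) ! ⟧))
arcsinh^S-even (suc l) zero =
  solve 3 (λ a b c → con 0ℚ :* a :* b := b :* c :* con 0ℚ) refl ⟦ (2 ℕ.* suc l) ! ⟧ ⟦ 1 ⟧ ⟦ 4 ℕ.^ suc l ⟧
arcsinh^S-even (suc l) (suc i) =
  subst₂ (λ J M → v J M * ⟦ M ! ⟧ * ⟦ 4 ℕ.^ suc i ⟧ ≡ ⟦ J ! ⟧ * ⟦ 4 ℕ.^ suc l ⟧ * signedStirling1₂ (suc l) (suc i))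
         (sym (2*suc i)) (sym (2*suc l)) (begin
    W2 * ⟦ suc (suc N) ! ⟧ * ⟦ 4 ℕ.^ suc i ⟧
      ≡⟨ cong₂ (λ x y → W2 * x * y) (⟦⟧-!-suc² N) (⟦⟧-4^-suc i) ⟩
    W2 * (⟦ suc (suc N) ⟧ * (⟦ suc N ⟧ * G)) * (T * T * Q)
      ≡⟨ solve 5 (λ w a b g h → w :* (a :* (b :* g)) :* h := (b :* (a :* w)) :* g :* h) refl W2 ⟦ suc (suc N) ⟧ ⟦ suc N ⟧ G (T * T * Q) ⟩
    (⟦ suc N ⟧ * (⟦ suc (suc N) ⟧ * W2)) * G * (T * T * Q)
      ≡⟨ cong (λ z → z * G * (T * T * Q)) top-coefficient ⟩
    (J2 * (J1 * v j N) + - ((T * L) * ((T * L) * V N))) * G * (T * T * Q)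
      ≡⟨ solve 8 (λ J2 J1 u T L y G Q → (J2 :* (J1 :* u) :+ :- ((T :* L) :* ((T :* L) :* y))) :* G :* (T :* T :* Q)
                   := J2 :* J1 :* (T :* T) :* (u :* G :* Q) :+ :- ((T :* L) :* (T :* L)) :* (y :* G :* (T :* T :* Q)))
               refl J2 J1 (v j N) T L (V N) G Q ⟩
    J2 * J1 * (T * T) * (v j N * G * Q) + - ((T * L) * (T * L)) * (V N * G * (T * T * Q))
      ≡⟨ cong₂ (λ p q → J2 * J1 * (T * T) * p + - ((T * L) * (T * L)) * q) (arcsinh^S-even l i) next-power ⟩
    J2 * J1 * (T * T) * (F * P * x) + - ((T * L) * (T * L)) * ((J2 * (J1 * F)) * P * y)
      ≡⟨ solve 8 (λ J2 J1 T F P x L y → J2 :* J1 :* (T :* T) :* (F :* P :* x) :+ :- ((T :* L) :* (T :* L)) :* ((J2 :* (J1 :* F)) :* P :* y)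
                   := (J2 :* (J1 :* F)) :* ((T :* T) :* P) :* (x :+ (:- (L :* L)) :* y))
               refl J2 J1 T F P x L y ⟩
    (J2 * (J1 * F)) * ((T * T) * P) * (x + (- (L * L)) * y)
      ≡⟨ cong₂ (λ p q → p * q * (x + (- (L * L)) * y)) (sym (⟦⟧-!-suc² j)) (sym (⟦⟧-4^-suc l)) ⟩
    ⟦ suc (suc j) ! ⟧ * ⟦ 4 ℕ.^ suc l ⟧ * (x + (- (L * L)) * y)
      ≡⟨ cong (λ z → ⟦ suc (suc j) ! ⟧ * ⟦ 4 ℕ.^ suc l ⟧ * (x + (- z) * y)) (sym (⟦⟧-* l l)) ⟩
    ⟦ suc (suc j) ! ⟧ * ⟦ 4 ℕ.^ suc l ⟧ * signedStirling1₂ (suc l) (suc i) ∎)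
  where
  v : ℕ → Series
  v i = arcsinh ^S i
  j = 2 ℕ.* i
  N = 2 ℕ.* l
  V = v (suc (suc j))
  W2 = V (suc (suc N))
  G = ⟦ N ! ⟧
  T = ⟦ 2 ⟧
  L = ⟦ l ⟧
  Q = ⟦ 4 ℕ.^ i ⟧
  P = ⟦ 4 ℕ.^ l ⟧
  J1 = ⟦ suc j ⟧
  J2 = ⟦ suc (suc j) ⟧
  F = ⟦ j ! ⟧
  x = signedStirling1₂ l i
  y = signedStirling1₂ l (suc i)
  next-power : V N * G * (T * T * Q) ≡ (J2 * (J1 * F)) * P * y
  next-power = begin
    V N * G * (T * T * Q)              ≡⟨ cong (V N * G *_) (⟦⟧-4^-suc i) ⟨
    V N * G * ⟦ 4 ℕ.^ suc i ⟧          ≡⟨ subst (λ J → v J N * G * ⟦ 4 ℕ.^ suc i ⟧ ≡ ⟦ J ! ⟧ * P * y) (2*suc i) (arcsinh^S-even l (suc i)) ⟩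
    ⟦ suc (suc j) ! ⟧ * P * y          ≡⟨ cong (λ z → z * P * y) (⟦⟧-!-suc² j) ⟩
    (J2 * (J1 * F)) * P * y            ∎
  top-coefficient : ⟦ suc N ⟧ * (⟦ suc (suc N) ⟧ * W2) ≡ J2 * (J1 * v j N) + - ((T * L) * ((T * L) * V N))
  top-coefficient = begin
    ⟦ suc N ⟧ * (⟦ suc (suc N) ⟧ * W2)
      ≡⟨ solve 2 (λ p q → p := (p :+ q) :+ :- q) refl (⟦ suc N ⟧ * (⟦ suc (suc N) ⟧ * W2)) ((T * L) * ((T * L) * V N)) ⟩
    (⟦ suc N ⟧ * (⟦ suc (suc N) ⟧ * W2) + (T * L) * ((T * L) * V N)) + - ((T * L) * ((T * L) * V N))
      ≡⟨ cong (λ z → (⟦ suc N ⟧ * (⟦ suc (suc N) ⟧ * W2) + z * (z * V N)) + - ((T * L) * ((T * L) * V N))) (sym (⟦⟧-* 2 l)) ⟩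
    (⟦ suc N ⟧ * (⟦ suc (suc N) ⟧ * W2) + ⟦ N ⟧ * (⟦ N ⟧ * V N)) + - ((T * L) * ((T * L) * V N))
      ≡⟨ cong (_+ - ((T * L) * ((T * L) * V N))) (arcsinh^S-recurrence j N) ⟩
    J2 * (J1 * v j N) + - ((T * L) * ((T * L) * V N)) ∎

stirling2₂-above-diagonal : ∀ m l → m ℕ.< l → stirling2₂ m l ≡ 0
stirling2₂-above-diagonal zero (suc l) _ = refl
stirling2₂-above-diagonal (suc m) (suc l) (ℕ.s≤s m<l) =
  cong₂ ℕ._+_ (stirling2₂-above-diagonal m l m<l)
              (trans (cong (suc l ℕ.* suc l ℕ.*_) (stirling2₂-above-diagonal m (suc l) (ℕP.m<n⇒m<1+n m<l)))
                     (ℕP.*-zeroʳ (suc l ℕ.* suc l)))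

signedStirling1₂-above-diagonal : ∀ l i → l ℕ.< i → signedStirling1₂ l i ≡ 0ℚ
signedStirling1₂-above-diagonal zero (suc i) _ = refl
signedStirling1₂-above-diagonal (suc l) (suc i) (ℕ.s≤s l<i) = begin
  signedStirling1₂ l i + (- ⟦ l ℕ.* l ⟧) * signedStirling1₂ l (suc i)
    ≡⟨ cong₂ (λ x y → x + (- ⟦ l ℕ.* l ⟧) * y) (signedStirling1₂-above-diagonal l i l<i)
                                               (signedStirling1₂-above-diagonal l (suc i) (ℕP.m<n⇒m<1+n l<i)) ⟩
  0ℚ + (- ⟦ l ℕ.* l ⟧) * 0ℚ
    ≡⟨ trans (QP.+-identityˡ _) (QP.*-zeroʳ (- ⟦ l ℕ.* l ⟧)) ⟩
  0ℚ ∎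

⟦stirling2₂⟧-suc : ∀ m l → ⟦ stirling2₂ (suc m) (suc l) ⟧ ≡ ⟦ stirling2₂ m l ⟧ + ⟦ suc l ℕ.* suc l ⟧ * ⟦ stirling2₂ m (suc l) ⟧
⟦stirling2₂⟧-suc m l = trans (⟦⟧-+ (stirling2₂ m l) _) (cong (⟦ stirling2₂ m l ⟧ +_) (⟦⟧-* (suc l ℕ.* suc l) (stirling2₂ m (suc l))))

stirling2₂-signedStirling1₂-orthogonal : ∀ m i N → m ℕ.< N →
  Σ< N (λ l → ⟦ stirling2₂ m l ⟧ * signedStirling1₂ l i) ≡ δ m i
stirling2₂-signedStirling1₂-orthogonal zero i (suc N) _ = begin
  Σ< (suc N) (λ l → ⟦ stirling2₂ 0 l ⟧ * signedStirling1₂ l i)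
    ≡⟨ Σ<-head N _ ⟩
  ⟦ 1 ⟧ * signedStirling1₂ 0 i + Σ< N (λ l → 0ℚ * signedStirling1₂ (suc l) i)
    ≡⟨ cong₂ _+_ (QP.*-identityˡ (signedStirling1₂ 0 i)) (Σ<-zero N (λ l _ → QP.*-zeroˡ (signedStirling1₂ (suc l) i))) ⟩
  signedStirling1₂ 0 i + 0ℚ
    ≡⟨ trans (QP.+-identityʳ _) (row₀ i) ⟩
  δ 0 i ∎
  where
  row₀ : ∀ i → signedStirling1₂ 0 i ≡ δ 0 i
  row₀ zero = refl
  row₀ (suc i) = refl
stirling2₂-signedStirling1₂-orthogonal (suc m) zero (suc N) _ = Σ<-zero (suc N) column₀
  where
  column₀ : ∀ l → l ℕ.< suc N → ⟦ stirling2₂ (suc m) l ⟧ * signedStirling1₂ l 0 ≡ 0ℚ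
  column₀ zero _ = QP.*-zeroˡ 1ℚ
  column₀ (suc l) _ = QP.*-zeroʳ ⟦ stirling2₂ (suc m) (suc l) ⟧
stirling2₂-signedStirling1₂-orthogonal (suc m) (suc i) (suc N) (ℕ.s≤s m<N) = begin
  Σ< (suc N) (λ l → S (suc m) l * t l (suc i))
    ≡⟨ Σ<-head-zero N _ (QP.*-zeroˡ (t 0 (suc i))) ⟩
  Σ< N (λ l → S (suc m) (suc l) * t (suc l) (suc i))
    ≡⟨ Σ<-cong N split ⟩
  Σ< N (λ l → S m l * t (suc l) (suc i) + g (suc l))
    ≡⟨ Σ<-distrib-+ N _ _ ⟩
  Σ< N (λ l → S m l * t (suc l) (suc i)) + Σ< N (λ l → g (suc l))
    ≡⟨ cong (Σ< N (λ l → S m l * t (suc l) (suc i)) +_) (Σ<-shift N g (QP.*-zeroˡ (S m 0 * t 0 (suc i))) g-N) ⟩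
  Σ< N (λ l → S m l * t (suc l) (suc i)) + Σ< N g
    ≡⟨ Σ<-distrib-+ N _ _ ⟨
  Σ< N (λ l → S m l * t (suc l) (suc i) + g l)
    ≡⟨ Σ<-cong N merge ⟩
  Σ< N (λ l → S m l * t l i)
    ≡⟨ stirling2₂-signedStirling1₂-orthogonal m i N m<N ⟩
  δ m i ∎
  where
  S : ℕ → ℕ → ℚ
  S m l = ⟦ stirling2₂ m l ⟧
  t = signedStirling1₂
  g : ℕ → ℚ
  g l = ⟦ l ℕ.* l ⟧ * (S m l * t l (suc i))
  g-N : g N ≡ 0ℚ
  g-N = begin
    ⟦ N ℕ.* N ⟧ * (⟦ stirling2₂ m N ⟧ * t N (suc i))  ≡⟨ cong (λ z → ⟦ N ℕ.* N ⟧ * (⟦ z ⟧ * t N (suc i))) (stirling2₂-above-diagonal m N m<N) ⟩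
    ⟦ N ℕ.* N ⟧ * (0ℚ * t N (suc i))                  ≡⟨ solve 2 (λ a b → a :* (con 0ℚ :* b) := con 0ℚ) refl ⟦ N ℕ.* N ⟧ (t N (suc i)) ⟩
    0ℚ                                                ∎
  split : ∀ l → S (suc m) (suc l) * t (suc l) (suc i) ≡ S m l * t (suc l) (suc i) + g (suc l)
  split l = trans (cong (_* t (suc l) (suc i)) (⟦stirling2₂⟧-suc m l))
    (solve 4 (λ a k b x → (a :+ k :* b) :* x := a :* x :+ k :* (b :* x)) refl (S m l) ⟦ suc l ℕ.* suc l ⟧ (S m (suc l)) (t (suc l) (suc i)))
  merge : ∀ l → S m l * t (suc l) (suc i) + g l ≡ S m l * t l i
  merge l = solve 5 (λ s x y k z → s :* (x :+ (:- k) :* z) :+ k :* (s :* z) := s :* x) refl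
                    (S m l) (t l i) (t (suc l) (suc i)) ⟦ l ℕ.* l ⟧ (t l (suc i))

sgn*stirling2₂ : ∀ n m → sgn (n ℕ.∸ m) * ⟦ stirling2₂ n m ⟧ ≡ signedStirling2₂ n m
sgn*stirling2₂ zero zero = refl
sgn*stirling2₂ zero (suc m) = refl
sgn*stirling2₂ (suc n) zero = QP.*-zeroʳ (sgn (suc n))
sgn*stirling2₂ (suc n) (suc m) = begin
  σ * ⟦ stirling2₂ (suc n) (suc m) ⟧
    ≡⟨ cong (σ *_) (⟦stirling2₂⟧-suc n m) ⟩
  σ * (⟦ stirling2₂ n m ⟧ + K * ⟦ stirling2₂ n (suc m) ⟧)
    ≡⟨ solve 4 (λ g x c y → g :* (x :+ c :* y) := g :* x :+ (:- c) :* (:- (g :* y))) refl σ ⟦ stirling2₂ n m ⟧ K ⟦ stirling2₂ n (suc m) ⟧ ⟩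
  σ * ⟦ stirling2₂ n m ⟧ + (- K) * (- (σ * ⟦ stirling2₂ n (suc m) ⟧))
    ≡⟨ cong₂ (λ x y → x + (- K) * y) (sgn*stirling2₂ n m) next-column ⟩
  signedStirling2₂ n m + (- K) * signedStirling2₂ n (suc m) ∎
  where
  σ = sgn (n ℕ.∸ m)
  K = ⟦ suc m ℕ.* suc m ⟧
  next-column : - (σ * ⟦ stirling2₂ n (suc m) ⟧) ≡ signedStirling2₂ n (suc m)
  next-column with m ℕP.<? n
  ... | yes m<n = begin
    - (σ * ⟦ stirling2₂ n (suc m) ⟧)                   ≡⟨ cong (λ z → - (sgn z * ⟦ stirling2₂ n (suc m) ⟧)) (ℕP.+-∸-assoc 1 m<n) ⟩
    - (- sgn (n ℕ.∸ suc m) * ⟦ stirling2₂ n (suc m) ⟧) ≡⟨ solve 2 (λ g x → :- (:- g :* x) := g :* x) refl (sgn (n ℕ.∸ suc m)) _ ⟩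
    sgn (n ℕ.∸ suc m) * ⟦ stirling2₂ n (suc m) ⟧       ≡⟨ sgn*stirling2₂ n (suc m) ⟩
    signedStirling2₂ n (suc m)                         ∎
  ... | no m≮n = begin
    - (σ * ⟦ stirling2₂ n (suc m) ⟧)               ≡⟨ cong (λ z → - (σ * ⟦ z ⟧)) vanishes ⟩
    - (σ * 0ℚ)                                     ≡⟨ trans (cong -_ (QP.*-zeroʳ σ)) (sym (QP.*-zeroʳ (sgn (n ℕ.∸ suc m)))) ⟩
    sgn (n ℕ.∸ suc m) * 0ℚ                         ≡⟨ cong (λ z → sgn (n ℕ.∸ suc m) * ⟦ z ⟧) vanishes ⟨
    sgn (n ℕ.∸ suc m) * ⟦ stirling2₂ n (suc m) ⟧   ≡⟨ sgn*stirling2₂ n (suc m) ⟩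
    signedStirling2₂ n (suc m)                     ∎
    where
    vanishes : stirling2₂ n (suc m) ≡ 0
    vanishes = stirling2₂-above-diagonal n (suc m) (ℕ.s≤s (ℕP.≮⇒≥ m≮n))

stirling2₂-inversion : ∀ M (b : ℕ → ℚ) →
  Σ< (suc M) (λ L → ⟦ stirling2₂ M L ⟧ * Σ< (suc L) (λ i → signedStirling1₂ L i * b i)) ≡ b M
stirling2₂-inversion M b = begin
  Σ< (suc M) (λ L → S L * Σ< (suc L) (λ i → t L i * b i))
    ≡⟨ Σ<-cong-< (suc M) (λ L L≤M → cong (S L *_) (sym (Σ<-extend (suc L) (suc M) L≤M
                                        (λ i L<i → trans (cong (_* b i) (signedStirling1₂-above-diagonal L i L<i)) (QP.*-zeroˡ (b i)))))) ⟩
  Σ< (suc M) (λ L → S L * Σ< (suc M) (λ i → t L i * b i))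
    ≡⟨ Σ<-cong (suc M) (λ L → sym (Σ<-*ˡ (suc M) (S L) _)) ⟩
  Σ< (suc M) (λ L → Σ< (suc M) (λ i → S L * (t L i * b i)))
    ≡⟨ Σ<-swap (suc M) (suc M) _ ⟩
  Σ< (suc M) (λ i → Σ< (suc M) (λ L → S L * (t L i * b i)))
    ≡⟨ Σ<-cong (suc M) (λ i → trans (Σ<-cong (suc M) (λ L → sym (QP.*-assoc (S L) (t L i) (b i)))) (Σ<-*ʳ (suc M) (b i) _)) ⟩
  Σ< (suc M) (λ i → Σ< (suc M) (λ L → S L * t L i) * b i)
    ≡⟨ Σ<-cong (suc M) (λ i → cong (_* b i) (stirling2₂-signedStirling1₂-orthogonal M i (suc M) (ℕP.n<1+n M))) ⟩
  Σ< (suc M) (λ i → δ M i * b i)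
    ≡⟨ Σ<-δ (suc M) M b (ℕP.n<1+n M) ⟩
  b M ∎
  where
  S : ℕ → ℚ
  S L = ⟦ stirling2₂ M L ⟧
  t = signedStirling1₂

polyBernoulli2-even : ∀ k n →
  polyBernoulli2 k (2 ℕ.* n) ≡ Σ< (suc n) (λ i → oddInvPow k i * (⟦ (2 ℕ.* i) ! ⟧ * signedStirling2₂ n i))
polyBernoulli2-even k n = begin
  ⟦ (2 ℕ.* n) ! ⟧ * (evenSeries (oddInvPow k) ∘S twoSinHalf) (2 ℕ.* n)
    ≡⟨ cong (⟦ (2 ℕ.* n) ! ⟧ *_) (∘S-evenSeries (oddInvPow k) twoSinHalf n) ⟩
  ⟦ (2 ℕ.* n) ! ⟧ * Σ< (suc n) (λ i → oddInvPow k i * u i)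
    ≡⟨ Σ<-*ˡ (suc n) ⟦ (2 ℕ.* n) ! ⟧ _ ⟨
  Σ< (suc n) (λ i → ⟦ (2 ℕ.* n) ! ⟧ * (oddInvPow k i * u i))
    ≡⟨ Σ<-cong (suc n) (λ i → trans (*-lcomm ⟦ (2 ℕ.* n) ! ⟧ (oddInvPow k i) (u i))
                                    (cong (oddInvPow k i *_) (trans (QP.*-comm ⟦ (2 ℕ.* n) ! ⟧ (u i)) (twoSinHalf^S-even n i)))) ⟩
  Σ< (suc n) (λ i → oddInvPow k i * (⟦ (2 ℕ.* i) ! ⟧ * signedStirling2₂ n i)) ∎
  where
  u : ℕ → ℚ
  u i = (twoSinHalf ^S (2 ℕ.* i)) (2 ℕ.* n)

polyCauchy2-even : ∀ k l →
  polyCauchy2 k (2 ℕ.* l) ≡ ⟦ 4 ℕ.^ l ⟧ * Σ< (suc l) (λ i → signedStirling1₂ l i * (oddInvPow k i * inv4^ i))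
polyCauchy2-even k l = begin
  ⟦ (2 ℕ.* l) ! ⟧ * (evenSeries c ∘S arcsinh) (2 ℕ.* l)
    ≡⟨ cong (⟦ (2 ℕ.* l) ! ⟧ *_) (∘S-evenSeries c arcsinh l) ⟩
  ⟦ (2 ℕ.* l) ! ⟧ * Σ< (suc l) (λ i → c i * v i)
    ≡⟨ Σ<-*ˡ (suc l) ⟦ (2 ℕ.* l) ! ⟧ _ ⟨
  Σ< (suc l) (λ i → ⟦ (2 ℕ.* l) ! ⟧ * (c i * v i))
    ≡⟨ Σ<-cong (suc l) term ⟩
  Σ< (suc l) (λ i → ⟦ 4 ℕ.^ l ⟧ * (signedStirling1₂ l i * (oddInvPow k i * inv4^ i)))
    ≡⟨ Σ<-*ˡ (suc l) ⟦ 4 ℕ.^ l ⟧ _ ⟩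
  ⟦ 4 ℕ.^ l ⟧ * Σ< (suc l) (λ i → signedStirling1₂ l i * (oddInvPow k i * inv4^ i)) ∎
  where
  c : ℕ → ℚ
  c i = inv! (2 ℕ.* i) * oddInvPow k i
  v : ℕ → ℚ
  v i = (arcsinh ^S (2 ℕ.* i)) (2 ℕ.* l)
  term : ∀ i → ⟦ (2 ℕ.* l) ! ⟧ * (c i * v i) ≡ ⟦ 4 ℕ.^ l ⟧ * (signedStirling1₂ l i * (oddInvPow k i * inv4^ i))
  term i = begin
    G * ((iF * A) * v i)                    ≡⟨ QP.*-identityʳ _ ⟨
    G * ((iF * A) * v i) * 1ℚ               ≡⟨ cong (G * ((iF * A) * v i) *_) (inv-inverseʳ (4 ℕ.^ i) {{ℕP.m^n≢0 4 i}}) ⟨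
    G * ((iF * A) * v i) * (Q * inv4^ i)
      ≡⟨ solve 6 (λ G iF A V Q iQ → G :* ((iF :* A) :* V) :* (Q :* iQ) := (iF :* A :* iQ) :* (V :* G :* Q)) refl G iF A (v i) Q (inv4^ i) ⟩
    (iF * A * inv4^ i) * (v i * G * Q)      ≡⟨ cong ((iF * A * inv4^ i) *_) (arcsinh^S-even l i) ⟩
    (iF * A * inv4^ i) * (F * P * t)
      ≡⟨ solve 6 (λ iF A iQ F P t → (iF :* A :* iQ) :* (F :* P :* t) := (iF :* F) :* (P :* (t :* (A :* iQ)))) refl iF A (inv4^ i) F P t ⟩
    (iF * F) * (P * (t * (A * inv4^ i)))    ≡⟨ cong (_* (P * (t * (A * inv4^ i)))) (inv-inverseˡ ((2 ℕ.* i) !) {{(2 ℕ.* i) !≢0}}) ⟩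
    1ℚ * (P * (t * (A * inv4^ i)))          ≡⟨ QP.*-identityˡ _ ⟩
    P * (t * (A * inv4^ i))                 ∎
    where
    G = ⟦ (2 ℕ.* l) ! ⟧
    iF = inv! (2 ℕ.* i)
    F = ⟦ (2 ℕ.* i) ! ⟧
    A = oddInvPow k i
    Q = ⟦ 4 ℕ.^ i ⟧
    P = ⟦ 4 ℕ.^ l ⟧
    t = signedStirling1₂ l i

rhs-term : ∀ k n M L → L ℕ.≤ M →
  sgn (n ℕ.∸ M) * ⟦ 4 ℕ.^ (M ℕ.∸ L) ℕ.* (2 ℕ.* M) ! ℕ.* stirling2₂ n M ℕ.* stirling2₂ M L ⟧ * polyCauchy2 k (2 ℕ.* L)
  ≡ (signedStirling2₂ n M * ⟦ (2 ℕ.* M) ! ⟧ * ⟦ 4 ℕ.^ M ⟧)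
    * (⟦ stirling2₂ M L ⟧ * Σ< (suc L) (λ i → signedStirling1₂ L i * (oddInvPow k i * inv4^ i)))
rhs-term k n M L L≤M = begin
  σ * ⟦ 4 ℕ.^ (M ℕ.∸ L) ℕ.* (2 ℕ.* M) ! ℕ.* stirling2₂ n M ℕ.* stirling2₂ M L ⟧ * polyCauchy2 k (2 ℕ.* L)
    ≡⟨ cong₂ (λ x y → σ * x * y) ⟦product⟧ (polyCauchy2-even k L) ⟩
  σ * (((p * F) * S₁) * S₂) * (⟦ 4 ℕ.^ L ⟧ * C)
    ≡⟨ solve 7 (λ σ p F S₁ S₂ q C → σ :* (((p :* F) :* S₁) :* S₂) :* (q :* C) := ((σ :* S₁) :* F :* (p :* q)) :* (S₂ :* C))
             refl σ p F S₁ S₂ ⟦ 4 ℕ.^ L ⟧ C ⟩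
  ((σ * S₁) * F * (p * ⟦ 4 ℕ.^ L ⟧)) * (S₂ * C)
    ≡⟨ cong₂ (λ x y → (x * F * y) * (S₂ * C)) (sgn*stirling2₂ n M) 4^M∸L*4^L ⟩
  (signedStirling2₂ n M * F * ⟦ 4 ℕ.^ M ⟧) * (S₂ * C) ∎
  where
  σ = sgn (n ℕ.∸ M)
  p = ⟦ 4 ℕ.^ (M ℕ.∸ L) ⟧
  F = ⟦ (2 ℕ.* M) ! ⟧
  S₁ = ⟦ stirling2₂ n M ⟧
  S₂ = ⟦ stirling2₂ M L ⟧
  C = Σ< (suc L) (λ i → signedStirling1₂ L i * (oddInvPow k i * inv4^ i))
  ⟦product⟧ : ⟦ 4 ℕ.^ (M ℕ.∸ L) ℕ.* (2 ℕ.* M) ! ℕ.* stirling2₂ n M ℕ.* stirling2₂ M L ⟧ ≡ ((p * F) * S₁) * S₂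
  ⟦product⟧ = trans (⟦⟧-* (4 ℕ.^ (M ℕ.∸ L) ℕ.* (2 ℕ.* M) ! ℕ.* stirling2₂ n M) (stirling2₂ M L))
                    (cong (_* S₂) (trans (⟦⟧-* (4 ℕ.^ (M ℕ.∸ L) ℕ.* (2 ℕ.* M) !) (stirling2₂ n M)) (cong (_* S₁) (⟦⟧-* (4 ℕ.^ (M ℕ.∸ L)) ((2 ℕ.* M) !)))))
  4^M∸L*4^L : p * ⟦ 4 ℕ.^ L ⟧ ≡ ⟦ 4 ℕ.^ M ⟧
  4^M∸L*4^L = trans (sym (⟦⟧-* (4 ℕ.^ (M ℕ.∸ L)) (4 ℕ.^ L)))
                    (cong ⟦_⟧ (trans (sym (ℕP.^-distribˡ-+-* 4 (M ℕ.∸ L) L)) (cong (4 ℕ.^_) (ℕP.m∸n+n≡m L≤M))))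

rhs-inner-sum : ∀ k n m →
  Σ[ 1 ⋯ suc m ] (λ l → sgn (n ℕ.∸ suc m) * ⟦ 4 ℕ.^ (suc m ℕ.∸ l) ℕ.* (2 ℕ.* suc m) ! ℕ.* stirling2₂ n (suc m) ℕ.* stirling2₂ (suc m) l ⟧
                          * polyCauchy2 k (2 ℕ.* l))
  ≡ oddInvPow k (suc m) * (⟦ (2 ℕ.* suc m) ! ⟧ * signedStirling2₂ n (suc m))
rhs-inner-sum k n m = begin
  Σ< (suc m) (λ l → sgn (n ℕ.∸ M) * ⟦ 4 ℕ.^ (M ℕ.∸ suc l) ℕ.* (2 ℕ.* M) ! ℕ.* stirling2₂ n M ℕ.* stirling2₂ M (suc l) ⟧
                    * polyCauchy2 k (2 ℕ.* suc l))
    ≡⟨ Σ<-cong-< (suc m) (λ l l≤m → rhs-term k n M (suc l) l≤m) ⟩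
  Σ< (suc m) (λ l → K * term (suc l))
    ≡⟨ Σ<-head-zero (suc m) (λ L → K * term L) (trans (cong (K *_) (QP.*-zeroˡ (C 0))) (QP.*-zeroʳ K)) ⟨
  Σ< (suc M) (λ L → K * term L)
    ≡⟨ Σ<-*ˡ (suc M) K term ⟩
  K * Σ< (suc M) term
    ≡⟨ cong (K *_) (stirling2₂-inversion M b) ⟩
  K * b M
    ≡⟨ solve 5 (λ s F q A iq → (s :* F :* q) :* (A :* iq) := A :* (F :* s) :* (q :* iq)) refl
             (signedStirling2₂ n M) ⟦ (2 ℕ.* M) ! ⟧ ⟦ 4 ℕ.^ M ⟧ (oddInvPow k M) (inv4^ M) ⟩
  oddInvPow k M * (⟦ (2 ℕ.* M) ! ⟧ * signedStirling2₂ n M) * (⟦ 4 ℕ.^ M ⟧ * inv4^ M)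
    ≡⟨ cong (oddInvPow k M * (⟦ (2 ℕ.* M) ! ⟧ * signedStirling2₂ n M) *_) (inv-inverseʳ (4 ℕ.^ M) {{ℕP.m^n≢0 4 M}}) ⟩
  oddInvPow k M * (⟦ (2 ℕ.* M) ! ⟧ * signedStirling2₂ n M) * 1ℚ
    ≡⟨ QP.*-identityʳ _ ⟩
  oddInvPow k M * (⟦ (2 ℕ.* M) ! ⟧ * signedStirling2₂ n M) ∎
  where
  M = suc m
  K = signedStirling2₂ n M * ⟦ (2 ℕ.* M) ! ⟧ * ⟦ 4 ℕ.^ M ⟧
  b : ℕ → ℚ
  b i = oddInvPow k i * inv4^ i
  C : ℕ → ℚ
  C L = Σ< (suc L) (λ i → signedStirling1₂ L i * b i)
  term : ℕ → ℚ
  term L = ⟦ stirling2₂ M L ⟧ * C L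

theorem8 : (n : ℕ) → n ℕ.≥ 1 → (k : ℤ) →
    polyBernoulli2 k (2 ℕ.* n) ≡
      Σ[ 1 ⋯ n ] (λ m → Σ[ 1 ⋯ m ] (λ l →
        sgn (n ℕ.∸ m) * ⟦ 4 ℕ.^ (m ℕ.∸ l) ℕ.* (2 ℕ.* m) ! ℕ.* stirling2₂ n m ℕ.* stirling2₂ m l ⟧
          * polyCauchy2 k (2 ℕ.* l)))
theorem8 (suc n) _ k = begin
  polyBernoulli2 k (2 ℕ.* suc n)
    ≡⟨ polyBernoulli2-even k (suc n) ⟩
  Σ< (suc (suc n)) (λ i → oddInvPow k i * (⟦ (2 ℕ.* i) ! ⟧ * signedStirling2₂ (suc n) i))
    ≡⟨ Σ<-head-zero (suc n) _ (QP.*-zeroʳ (oddInvPow k 0)) ⟩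
  Σ< (suc n) (λ m → oddInvPow k (suc m) * (⟦ (2 ℕ.* suc m) ! ⟧ * signedStirling2₂ (suc n) (suc m)))
    ≡⟨ Σ<-cong (suc n) (λ m → rhs-inner-sum k (suc n) m) ⟨
  Σ[ 1 ⋯ suc n ] (λ m → Σ[ 1 ⋯ m ] (λ l →
    sgn (suc n ℕ.∸ m) * ⟦ 4 ℕ.^ (m ℕ.∸ l) ℕ.* (2 ℕ.* m) ! ℕ.* stirling2₂ (suc n) m ℕ.* stirling2₂ m l ⟧
      * polyCauchy2 k (2 ℕ.* l))) ∎
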